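{- The function $g$ has no finite-fold Diophantine representation; that is, there is no polynomial $W(x_1,x_2,x_3,\ldots,x_m)$ with integer coefficients such that for all non-negative integers $x_1,x_2$ one has $x_2=g(x_1)$ (with $x_1\geq 1$) if and only if there exist $x_3,\ldots,x_m\in\mathbb{N}$ with $W(x_1,x_2,x_3,\ldots,x_m)=0$, and such that for all $x_1,x_2\in\mathbb{N}$ the equation $W(x_1,x_2,x_3,\ldots,x_m)=0$ has only finitely many solutions $(x_3,\ldots,x_m)\in\mathbb{N}^{m-2}$.
   Context: $\mathbb{N}=\{0,1,2,\ldots\}$. For a positive integer $n$, let $E_n=\{x_i=1,\ x_i+x_j=x_k,\ x_i\cdot x_j=x_k : i,j,k\in\{1,\ldots,n\}\}$. Let $g(n)$ denote the greatest finite total number of solutions of a subsystem of $E_n$ in integers $x_1,\ldots,x_n$ (i.e., the maximum, over all systems $S\subseteq E_n$ having only finitely many integer solutions, of the number of integer solutions of $S$). A Diophantine representation of a set $\mathcal{M}\subseteq\mathbb{N}^k$ is a polynomial $W(a_1,\ldots,a_k,x_1,\ldots,x_m)$ with integer coefficients such that $(a_1,\ldots,a_k)\in\mathcal{M}$ iff $\exists x_1,\ldots,x_m\in\mathbb{N}\ W(a_1,\ldots,a_k,x_1,\ldots,x_m)=0$; it is finite-fold if for every $(a_1,\ldots,a_k)\in\mathbb{N}^k$ the equation has only finitely many solutions $(x_1,\ldots,x_m)\in\mathbb{N}^m$. A Diophantine representation of a function is one of its graph. -}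

module Defs where

open import Data.Nat using (ℕ; suc; _≤_)
open import Data.Integer as ℤ using (ℤ; +_)
open import Data.Fin using (Fin)
open import Data.Vec using (Vec; lookup; map; _∷_)
open import Data.List using (List; length)
open import Data.List.Membership.Propositional using (_∈_)
open import Data.List.Relation.Unary.All using (All)
open import Data.List.Relation.Unary.Unique.Propositional using (Unique)
open import Data.Product using (Σ; ∃; _×_)
open import Relation.Binary.PropositionalEquality using (_≡_)

-- The equations of E_n, over variables x_1..x_n indexed by Fin n.
data Eqn (n : ℕ) : Set where
  one : Fin n → Eqn n
  add : Fin n → Fin n → Fin n → Eqn n
  mul : Fin n → Fin n → Fin n → Eqn n

Sat : ∀ {n} → Vec ℤ n → Eqn n → Set
Sat x (one i)     = lookup x i ≡ ℤ.+ 1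
Sat x (add i j k) = lookup x i ℤ.+ lookup x j ≡ lookup x k
Sat x (mul i j k) = lookup x i ℤ.* lookup x j ≡ lookup x k

-- A subsystem S ⊆ E_n, given as a finite list of its equations.
System : ℕ → Set
System n = List (Eqn n)

Solution : ∀ {n} → System n → Vec ℤ n → Set
Solution S x = All (Sat x) S

HasExactlySolutions : ∀ {n} → System n → ℕ → Set
HasExactlySolutions {n} S k =
  Σ (List (Vec ℤ n)) λ L →
    Unique L × length L ≡ k × (∀ x → Solution S x → x ∈ L) × All (Solution S) L

FinitelyManySolutions : ∀ {n} → System n → Set
FinitelyManySolutions {n} S =
  Σ (List (Vec ℤ n)) λ L → ∀ x → Solution S x → x ∈ L

-- IsG n k : k = g(n), i.e. k is the greatest number of integer solutions of a
-- subsystem of E_n having only finitely many integer solutions.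
IsG : ℕ → ℕ → Set
IsG n k =
  (Σ (System n) λ S → HasExactlySolutions S k)
  × (∀ (S : System n) (c : ℕ) → HasExactlySolutions S c → c ≤ k)

data Poly (m : ℕ) : Set where
  var   : Fin m → Poly m
  const : ℤ → Poly m
  _⊕_   : Poly m → Poly m → Poly m
  _⊗_   : Poly m → Poly m → Poly m

eval : ∀ {m} → Poly m → Vec ℤ m → ℤ
eval (var i)   x = lookup x i
eval (const c) x = c
eval (p ⊕ q)   x = eval p x ℤ.+ eval q x
eval (p ⊗ q)   x = eval p x ℤ.* eval q x

evalℕ : ∀ {m} → Poly m → Vec ℕ m → ℤ
evalℕ W x = eval W (map +_ x)

-- Suppose W were a finite-fold representation of g. By Lagrange's four-square theorem the natural
-- unknowns of W may be replaced by sums of four squares of integers, and the resulting integer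
-- polynomial, together with the condition a = 2^k, compiles into a system S ⊆ E_n whose integer
-- solutions correspond to its zeros. The size of S grows linearly in k, so S ⊆ E_(2^k) for large k.
-- As W represents g, every solution has b = g(2^k), and finite-foldness then bounds all unknowns:
-- S has finitely many solutions, hence at most g(2^k) of them. Yet writing b = y + (b - y) with
-- both summands as sums of four squares, for y = 0, …, b, yields g(2^k) + 1 distinct solutions.
-- The existence of g(2^k) is only available under a double negation, which suffices for a negated claim.

module Submission where

module Preliminaries where

  open import Data.Nat using (ℕ; zero; suc; z≤n; s≤s; _+_; _*_; _^_; _≤_; _<_)
  open import Data.Nat.Properties
  open import Data.Product using (∃-syntax; _,_)
  open import Data.Vec as Vec using (Vec; lookup)
  open import Data.Fin using (Fin; combine)
  open import Data.Nat.ListAction using (sum)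
  import Data.Vec.Properties as VecP
  open import Data.List using (List; []; _∷_; length)
  open import Data.List.Membership.Propositional using (_∈_)
  open import Data.List.Relation.Unary.Any using (here; there)
  import Data.List.Relation.Unary.All as All
  open import Data.List.Relation.Unary.Unique.Propositional using (Unique)
  open import Data.List.Relation.Unary.AllPairs using (_∷_)
  open import Data.Empty using (⊥-elim)
  open import Relation.Binary.PropositionalEquality
  import Data.Nat.Tactic.RingSolver as ℕ-Solver

  lookup-ext : ∀ {A : Set} {n} {xs ys : Vec A n} → (∀ i → lookup xs i ≡ lookup ys i) → xs ≡ ys
  lookup-ext {xs = xs} {ys} eq = trans (sym (VecP.tabulate∘lookup xs)) (trans (VecP.tabulate-cong eq) (VecP.tabulate∘lookup ys))

  module _ {A : Set} where

    remove : ∀ {x : A} ys → x ∈ ys → List A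
    remove (y ∷ ys) (here _)  = ys
    remove (y ∷ ys) (there p) = y ∷ remove ys p

    length-remove : ∀ {x : A} ys (p : x ∈ ys) → length ys ≡ suc (length (remove ys p))
    length-remove (y ∷ ys) (here _)  = refl
    length-remove (y ∷ ys) (there p) = cong suc (length-remove ys p)

    ∈-remove : ∀ {x z : A} ys (p : x ∈ ys) → z ∈ ys → z ≢ x → z ∈ remove ys p
    ∈-remove (y ∷ ys) (here refl) (here refl) z≢x = ⊥-elim (z≢x refl)
    ∈-remove (y ∷ ys) (here refl) (there q)   _   = q
    ∈-remove (y ∷ ys) (there p)   (here refl) _   = here refl
    ∈-remove (y ∷ ys) (there p)   (there q)   z≢x = there (∈-remove ys p q z≢x)

    unique-⊆⇒length-≤ : ∀ (xs ys : List A) → Unique xs → (∀ {x} → x ∈ xs → x ∈ ys) → length xs ≤ length ys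
    unique-⊆⇒length-≤ []       ys _              _  = z≤n
    unique-⊆⇒length-≤ (x ∷ xs) ys (x∉xs ∷ uniq) xs⊆ys =
      subst (suc (length xs) ≤_) (sym (length-remove ys x∈ys))
        (s≤s (unique-⊆⇒length-≤ xs (remove ys x∈ys) uniq
          (λ z∈xs → ∈-remove ys x∈ys (xs⊆ys (there z∈xs)) (λ z≡x → All.lookup x∉xs z∈xs (sym z≡x)))))
      where x∈ys = xs⊆ys (here refl)


  n<2^n : ∀ n → n < 2 ^ n
  n<2^n zero    = s≤s z≤n
  n<2^n (suc n) = +-mono-≤ (≤-trans (s≤s z≤n) (n<2^n n)) (subst (suc n ≤_) (sym (+-identityʳ (2 ^ n))) (n<2^n n))

  linear<exponential : ∀ α c → ∃[ k ] α + c * k ≤ 2 ^ k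
  linear<exponential α c = j + j , (begin
    α + c * (j + j)              ≡⟨ cong (α +_) (double c j) ⟩
    α + 2 * c * j                ≤⟨ +-mono-≤ (m≤m*n α (suc j)) (*-monoʳ-≤ (2 * c) (n≤1+n j)) ⟩
    α * suc j + 2 * c * suc j    ≡⟨ sym (*-distribʳ-+ (suc j) α (2 * c)) ⟩
    j * suc j                    ≤⟨ *-monoˡ-≤ (suc j) (n≤1+n j) ⟩
    suc j * suc j                ≤⟨ *-mono-≤ (n<2^n j) (n<2^n j) ⟩
    2 ^ j * 2 ^ j                ≡⟨ sym (^-distribˡ-+-* 2 j j) ⟩
    2 ^ (j + j)                  ∎)
    where
    open ≤-Reasoning
    j = α + 2 * c
    double : ∀ c j → c * (j + j) ≡ 2 * c * j
    double = ℕ-Solver.solve-∀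

  lookup≤sum : ∀ {n} (v : Vec ℕ n) i → lookup v i ≤ Vec.sum v
  lookup≤sum (x Vec.∷ v) Fin.zero    = m≤m+n x (Vec.sum v)
  lookup≤sum (x Vec.∷ v) (Fin.suc i) = ≤-trans (lookup≤sum v i) (m≤n+m (Vec.sum v) x)

  ∈⇒≤sum : ∀ {n ns} → n ∈ ns → n ≤ sum ns
  ∈⇒≤sum {ns = n ∷ ns} (here refl) = m≤m+n n (sum ns)
  ∈⇒≤sum {ns = m ∷ ns} (there n∈)  = ≤-trans (∈⇒≤sum n∈) (m≤n+m (sum ns) m)

  lookup-concat : ∀ {A : Set} {n k} (xss : Vec (Vec A k) n) i j → lookup (Vec.concat xss) (combine i j) ≡ lookup (lookup xss i) j
  lookup-concat (xs Vec.∷ xss) Fin.zero    j = VecP.lookup-++ˡ xs (Vec.concat xss) j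
  lookup-concat (xs Vec.∷ xss) (Fin.suc i) j = trans (VecP.lookup-++ʳ xs (Vec.concat xss) (combine i j)) (lookup-concat xss i j)


module FourSquares where

  open import Data.Nat as ℕ using (ℕ; zero; suc; z≤n; s≤s; _≤_)
  import Data.Nat.Properties as ℕP
  import Data.Nat.DivMod as ℕD
  open import Data.Integer as ℤ using (ℤ; +_; -[1+_]; -_; _+_; _*_; _-_; ∣_∣)
  import Data.Integer.Properties as ℤP
  open import Data.Integer.DivMod using (_/_; _%_; a≡a%n+[a/n]*n; n%d<d)
  open import Data.Product using (∃-syntax; _×_; _,_; proj₁; proj₂)
  open import Data.Sum using (_⊎_; inj₁; inj₂)
  open import Data.Fin as Fin using (Fin)
  open import Data.Vec using (Vec; []; _∷_; lookup)
  open import Relation.Binary.PropositionalEquality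
  open import Data.Integer.Tactic.RingSolver using (solve-∀)

  sumSq₄ : ℤ → ℤ → ℤ → ℤ → ℤ
  sumSq₄ a b c d = a * a + b * b + c * c + d * d

  IsSumOfFourSquares : ℤ → Set
  IsSumOfFourSquares n = ∃[ a ] ∃[ b ] ∃[ c ] ∃[ d ] n ≡ sumSq₄ a b c d

  sumSqℕ₄ : ℕ → ℕ → ℕ → ℕ → ℕ
  sumSqℕ₄ a b c d = a ℕ.* a ℕ.+ b ℕ.* b ℕ.+ c ℕ.* c ℕ.+ d ℕ.* d

  x*x≡∣x∣*∣x∣ : ∀ x → x * x ≡ + (∣ x ∣ ℕ.* ∣ x ∣)
  x*x≡∣x∣*∣x∣ (+ n)    = sym (ℤP.pos-* n n)
  x*x≡∣x∣*∣x∣ -[1+ n ] = refl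

  sumSq₄≡sumSqℕ₄-abs : ∀ a b c d → sumSq₄ a b c d ≡ + sumSqℕ₄ (∣ a ∣) (∣ b ∣) (∣ c ∣) (∣ d ∣)
  sumSq₄≡sumSqℕ₄-abs a b c d
    rewrite x*x≡∣x∣*∣x∣ a | x*x≡∣x∣*∣x∣ b | x*x≡∣x∣*∣x∣ c | x*x≡∣x∣*∣x∣ d = refl

  euler-four-square-identity : ∀ a b c d e f g h →
    sumSq₄ a b c d * sumSq₄ e f g h ≡
    sumSq₄ (a * e + b * f + c * g + d * h) (a * f - b * e + c * h - d * g)
           (a * g - b * h - c * e + d * f) (a * h + b * g - c * f - d * e)
  euler-four-square-identity = identity
    where
    identity : ∀ a b c d e f g h →
      (a * a + b * b + c * c + d * d) * (e * e + f * f + g * g + h * h) ≡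
        (a * e + b * f + c * g + d * h) * (a * e + b * f + c * g + d * h)
      + (a * f - b * e + c * h - d * g) * (a * f - b * e + c * h - d * g)
      + (a * g - b * h - c * e + d * f) * (a * g - b * h - c * e + d * f)
      + (a * h + b * g - c * f - d * e) * (a * h + b * g - c * f - d * e)
    identity = solve-∀

  *-isSumOfFourSquares : ∀ {m n} → IsSumOfFourSquares m → IsSumOfFourSquares n → IsSumOfFourSquares (m * n)
  *-isSumOfFourSquares (a , b , c , d , refl) (e , f , g , h , refl) =
      a * e + b * f + c * g + d * h , a * f - b * e + c * h - d * g
    , a * g - b * h - c * e + d * f , a * h + b * g - c * f - d * e
    , euler-four-square-identity a b c d e f g h

  parity : ℤ → ℕ
  parity x = x % + 2

  half : ℤ → ℤ
  half x = x / + 2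

  x≡parity+half*2 : ∀ x → x ≡ + parity x + half x * + 2
  x≡parity+half*2 x = a≡a%n+[a/n]*n x (+ 2)

  parity<2 : ∀ x → parity x ℕ.< 2
  parity<2 x = n%d<d x (+ 2)

  parity≡⇒≡+2* : ∀ x y → parity x ≡ parity y → x ≡ y + + 2 * (half x - half y)
  parity≡⇒≡+2* x y eq = begin
    x                                   ≡⟨ x≡parity+half*2 x ⟩
    + parity x + half x * + 2           ≡⟨ cong (λ e → + e + half x * + 2) eq ⟩
    + parity y + half x * + 2           ≡⟨ shift (+ parity y) (half x) (half y) ⟩
    (+ parity y + half y * + 2) + + 2 * (half x - half y)
                                        ≡⟨ cong (_+ + 2 * (half x - half y)) (sym (x≡parity+half*2 y)) ⟩
    y + + 2 * (half x - half y)         ∎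
    where
    open ≡-Reasoning
    shift : ∀ e p q → e + p * + 2 ≡ (e + q * + 2) + + 2 * (p - q)
    shift = solve-∀

  x*x≡x-mod2 : ∀ x → ∃[ q ] x * x ≡ + 2 * q + + parity x
  x*x≡x-mod2 x = q , (begin
    x * x                          ≡⟨ cong (λ y → y * y) (x≡parity+half*2 x) ⟩
    (e + h * + 2) * (e + h * + 2)  ≡⟨ expand e h ⟩
    + 2 * q + e * e                ≡⟨ cong (λ y → + 2 * q + y) (e*e≡e (parity<2 x)) ⟩
    + 2 * q + e                    ∎)
    where
    open ≡-Reasoning
    e = + parity x
    h = half x
    q = + 2 * (h * h) + + 2 * (h * e)
    expand : ∀ e h → (e + h * + 2) * (e + h * + 2) ≡ + 2 * (+ 2 * (h * h) + + 2 * (h * e)) + e * e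
    expand = solve-∀
    e*e≡e : ∀ {n} → n ℕ.< 2 → + n * + n ≡ + n
    e*e≡e (s≤s z≤n)       = refl
    e*e≡e (s≤s (s≤s z≤n)) = refl

  sumSq₄-parities-even : ∀ X a b c d → + 2 * X ≡ sumSq₄ a b c d →
    (parity a ℕ.+ parity b ℕ.+ parity c ℕ.+ parity d) ℕD.% 2 ≡ 0
  sumSq₄-parities-even X a b c d eq
    with x*x≡x-mod2 a | x*x≡x-mod2 b | x*x≡x-mod2 c | x*x≡x-mod2 d
  ... | qa , ea | qb , eb | qc , ec | qd , ed =
    subst (λ n → n ℕD.% 2 ≡ 0) (sym E≡∣X-Q∣*2) (ℕD.m*n%n≡0 ∣ X - Q ∣ 2)
    where
    open ≡-Reasoning
    pa = parity a ; pb = parity b ; pc = parity c ; pd = parity d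
    E = pa ℕ.+ pb ℕ.+ pc ℕ.+ pd
    Q = qa + qb + qc + qd
    collect : ∀ qa qb qc qd ea eb ec ed →
      (+ 2 * qa + ea) + (+ 2 * qb + eb) + (+ 2 * qc + ec) + (+ 2 * qd + ed)
        ≡ + 2 * (qa + qb + qc + qd) + (ea + eb + ec + ed)
    collect = solve-∀
    solve-for-E : ∀ X Q E → + 2 * X ≡ + 2 * Q + E → E ≡ + 2 * (X - Q)
    solve-for-E X Q E eq = trans (isolate X Q E) (trans (cong (_- + 2 * Q) (sym eq)) (factor X Q))
      where
      isolate : ∀ X Q E → E ≡ (+ 2 * Q + E) - + 2 * Q
      isolate = solve-∀
      factor : ∀ X Q → + 2 * X - + 2 * Q ≡ + 2 * (X - Q)
      factor = solve-∀
    expansion : sumSq₄ a b c d ≡ + 2 * Q + + E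
    expansion = begin
      sumSq₄ a b c d                              ≡⟨ cong₂ _+_ (cong₂ _+_ (cong₂ _+_ ea eb) ec) ed ⟩
      (+ 2 * qa + + pa) + (+ 2 * qb + + pb) + (+ 2 * qc + + pc) + (+ 2 * qd + + pd)
                                                  ≡⟨ collect qa qb qc qd (+ pa) (+ pb) (+ pc) (+ pd) ⟩
      + 2 * Q + (+ pa + + pb + + pc + + pd)       ≡⟨ cong (λ y → + 2 * Q + y) (sym (trans (ℤP.pos-+ (pa ℕ.+ pb ℕ.+ pc) pd)
                                                       (cong (_+ + pd) (trans (ℤP.pos-+ (pa ℕ.+ pb) pc)
                                                         (cong (_+ + pc) (ℤP.pos-+ pa pb)))))) ⟩
      + 2 * Q + + E                               ∎
    E≡∣X-Q∣*2 : E ≡ ∣ X - Q ∣ ℕ.* 2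
    E≡∣X-Q∣*2 = trans (cong ∣_∣ (solve-for-E X Q (+ E) (trans eq expansion)))
                      (trans (ℤP.abs-* (+ 2) (X - Q)) (ℕP.*-comm 2 ∣ X - Q ∣))

  even-bits⇒two-equal-pairs : ∀ {ea eb ec ed} → ea ℕ.< 2 → eb ℕ.< 2 → ec ℕ.< 2 → ed ℕ.< 2 →
    (ea ℕ.+ eb ℕ.+ ec ℕ.+ ed) ℕD.% 2 ≡ 0 →
    (ea ≡ eb × ec ≡ ed) ⊎ (ea ≡ ec × eb ≡ ed) ⊎ (ea ≡ ed × eb ≡ ec)
  even-bits⇒two-equal-pairs (s≤s z≤n) (s≤s z≤n) (s≤s z≤n) (s≤s z≤n) _ = inj₁ (refl , refl)
  even-bits⇒two-equal-pairs (s≤s z≤n) (s≤s z≤n) (s≤s z≤n) (s≤s (s≤s z≤n)) ()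
  even-bits⇒two-equal-pairs (s≤s z≤n) (s≤s z≤n) (s≤s (s≤s z≤n)) (s≤s z≤n) ()
  even-bits⇒two-equal-pairs (s≤s z≤n) (s≤s z≤n) (s≤s (s≤s z≤n)) (s≤s (s≤s z≤n)) _ = inj₁ (refl , refl)
  even-bits⇒two-equal-pairs (s≤s z≤n) (s≤s (s≤s z≤n)) (s≤s z≤n) (s≤s z≤n) ()
  even-bits⇒two-equal-pairs (s≤s z≤n) (s≤s (s≤s z≤n)) (s≤s z≤n) (s≤s (s≤s z≤n)) _ = inj₂ (inj₁ (refl , refl))
  even-bits⇒two-equal-pairs (s≤s z≤n) (s≤s (s≤s z≤n)) (s≤s (s≤s z≤n)) (s≤s z≤n) _ = inj₂ (inj₂ (refl , refl))
  even-bits⇒two-equal-pairs (s≤s z≤n) (s≤s (s≤s z≤n)) (s≤s (s≤s z≤n)) (s≤s (s≤s z≤n)) ()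
  even-bits⇒two-equal-pairs (s≤s (s≤s z≤n)) (s≤s z≤n) (s≤s z≤n) (s≤s z≤n) ()
  even-bits⇒two-equal-pairs (s≤s (s≤s z≤n)) (s≤s z≤n) (s≤s z≤n) (s≤s (s≤s z≤n)) _ = inj₂ (inj₂ (refl , refl))
  even-bits⇒two-equal-pairs (s≤s (s≤s z≤n)) (s≤s z≤n) (s≤s (s≤s z≤n)) (s≤s z≤n) _ = inj₂ (inj₁ (refl , refl))
  even-bits⇒two-equal-pairs (s≤s (s≤s z≤n)) (s≤s z≤n) (s≤s (s≤s z≤n)) (s≤s (s≤s z≤n)) ()
  even-bits⇒two-equal-pairs (s≤s (s≤s z≤n)) (s≤s (s≤s z≤n)) (s≤s z≤n) (s≤s z≤n) _ = inj₁ (refl , refl)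
  even-bits⇒two-equal-pairs (s≤s (s≤s z≤n)) (s≤s (s≤s z≤n)) (s≤s z≤n) (s≤s (s≤s z≤n)) ()
  even-bits⇒two-equal-pairs (s≤s (s≤s z≤n)) (s≤s (s≤s z≤n)) (s≤s (s≤s z≤n)) (s≤s z≤n) ()
  even-bits⇒two-equal-pairs (s≤s (s≤s z≤n)) (s≤s (s≤s z≤n)) (s≤s (s≤s z≤n)) (s≤s (s≤s z≤n)) _ = inj₁ (refl , refl)

  half-of-paired-sumSq₄ : ∀ X b v d w →
    + 2 * X ≡ sumSq₄ (b + + 2 * v) b (d + + 2 * w) d → IsSumOfFourSquares X
  half-of-paired-sumSq₄ X b v d w eq =
    b + v , v , d + w , w , ℤP.*-cancelˡ-≡ (+ 2) X _ (trans eq (halve b v d w))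
    where
    halve : ∀ b v d w →
      (b + + 2 * v) * (b + + 2 * v) + b * b + (d + + 2 * w) * (d + + 2 * w) + d * d
        ≡ + 2 * ((b + v) * (b + v) + v * v + (d + w) * (d + w) + w * w)
    halve = solve-∀

  half-isSumOfFourSquares : ∀ X → IsSumOfFourSquares (+ 2 * X) → IsSumOfFourSquares X
  half-isSumOfFourSquares X (a , b , c , d , eq) =
    pair-up (even-bits⇒two-equal-pairs (parity<2 a) (parity<2 b) (parity<2 c) (parity<2 d)
                                       (sumSq₄-parities-even X a b c d eq))
    where
    pair : ∀ a b c d → parity a ≡ parity b → parity c ≡ parity d →
      + 2 * X ≡ sumSq₄ a b c d → IsSumOfFourSquares X
    pair a b c d ab cd eq'
      rewrite parity≡⇒≡+2* a b ab | parity≡⇒≡+2* c d cd = half-of-paired-sumSq₄ X b _ d _ eq'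
    swap-bc : ∀ a b c d → a * a + b * b + c * c + d * d ≡ a * a + c * c + b * b + d * d
    swap-bc = solve-∀
    swap-bd : ∀ a b c d → a * a + b * b + c * c + d * d ≡ a * a + d * d + b * b + c * c
    swap-bd = solve-∀
    pair-up : (parity a ≡ parity b × parity c ≡ parity d) ⊎ (parity a ≡ parity c × parity b ≡ parity d)
            ⊎ (parity a ≡ parity d × parity b ≡ parity c) → IsSumOfFourSquares X
    pair-up (inj₁ (ab , cd))        = pair a b c d ab cd eq
    pair-up (inj₂ (inj₁ (ac , bd))) = pair a c b d ac bd (trans eq (swap-bc a b c d))
    pair-up (inj₂ (inj₂ (ad , bc))) = pair a d b c ad bc (trans eq (swap-bd a b c d))

  x²+y²≡0⇒ : ∀ x y → x * x + y * y ≡ + 0 → x ≡ + 0 × y ≡ + 0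
  x²+y²≡0⇒ x y eq = ℤP.∣i∣≡0⇒i≡0 (proj₁ ∣x∣,∣y∣≡0) , ℤP.∣i∣≡0⇒i≡0 (proj₂ ∣x∣,∣y∣≡0)
    where
    squares≡0 : ∀ a b → a ℕ.* a ℕ.+ b ℕ.* b ≡ 0 → a ≡ 0 × b ≡ 0
    squares≡0 zero zero _ = refl , refl
    ∣x∣,∣y∣≡0 = squares≡0 ∣ x ∣ ∣ y ∣ (ℤP.+-injective (begin
      + (∣ x ∣ ℕ.* ∣ x ∣ ℕ.+ ∣ y ∣ ℕ.* ∣ y ∣)       ≡⟨ ℤP.pos-+ (∣ x ∣ ℕ.* ∣ x ∣) (∣ y ∣ ℕ.* ∣ y ∣) ⟩
      + (∣ x ∣ ℕ.* ∣ x ∣) + + (∣ y ∣ ℕ.* ∣ y ∣)     ≡⟨ sym (cong₂ _+_ (x*x≡∣x∣*∣x∣ x) (x*x≡∣x∣*∣x∣ y)) ⟩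
      x * x + y * y                                 ≡⟨ eq ⟩
      + 0                                           ∎))
      where open ≡-Reasoning

  sumSqVec : Vec ℤ 4 → ℤ
  sumSqVec (a ∷ b ∷ c ∷ d ∷ []) = sumSq₄ a b c d

  normSq : Vec ℤ 4 → ℕ
  normSq (a ∷ b ∷ c ∷ d ∷ []) = sumSqℕ₄ (∣ a ∣) (∣ b ∣) (∣ c ∣) (∣ d ∣)

  sumSqVec≡normSq : ∀ v → sumSqVec v ≡ + normSq v
  sumSqVec≡normSq (a ∷ b ∷ c ∷ d ∷ []) = sumSq₄≡sumSqℕ₄-abs a b c d

  entry²≤normSq : ∀ v r → ∣ lookup v r ∣ ℕ.* ∣ lookup v r ∣ ≤ normSq v
  entry²≤normSq (a ∷ b ∷ c ∷ d ∷ []) r = bound r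
    where
    sq : ℤ → ℕ
    sq x = ∣ x ∣ ℕ.* ∣ x ∣
    bound : ∀ r → sq (lookup (a ∷ b ∷ c ∷ d ∷ []) r) ≤ sq a ℕ.+ sq b ℕ.+ sq c ℕ.+ sq d
    bound Fin.zero = ℕP.≤-trans (ℕP.m≤m+n (sq a) (sq b))
      (ℕP.≤-trans (ℕP.m≤m+n (sq a ℕ.+ sq b) (sq c)) (ℕP.m≤m+n (sq a ℕ.+ sq b ℕ.+ sq c) (sq d)))
    bound (Fin.suc Fin.zero) = ℕP.≤-trans (ℕP.m≤n+m (sq b) (sq a))
      (ℕP.≤-trans (ℕP.m≤m+n (sq a ℕ.+ sq b) (sq c)) (ℕP.m≤m+n (sq a ℕ.+ sq b ℕ.+ sq c) (sq d)))
    bound (Fin.suc (Fin.suc Fin.zero)) =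
      ℕP.≤-trans (ℕP.m≤n+m (sq c) (sq a ℕ.+ sq b)) (ℕP.m≤m+n (sq a ℕ.+ sq b ℕ.+ sq c) (sq d))
    bound (Fin.suc (Fin.suc (Fin.suc Fin.zero))) = ℕP.m≤n+m (sq d) (sq a ℕ.+ sq b ℕ.+ sq c)

  ∣entry∣≤normSq : ∀ v r → ∣ lookup v r ∣ ≤ normSq v
  ∣entry∣≤normSq v r = ℕP.≤-trans (n≤n*n ∣ lookup v r ∣) (entry²≤normSq v r)
    where
    n≤n*n : ∀ n → n ≤ n ℕ.* n
    n≤n*n zero    = z≤n
    n≤n*n (suc n) = ℕP.m≤m*n (suc n) (suc n)


module FourSquareDescent where

  open FourSquares
  open import Data.Nat as ℕ using (ℕ; zero; suc; z≤n; s≤s)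
  import Data.Nat.Properties as ℕP
  open import Data.Nat.Divisibility using (_∣_; divides)
  open import Data.Nat.Primality using (Prime; composite)
  open import Data.Integer as ℤ using (+_; -[1+_]; -_; _+_; _*_; _-_; ∣_∣)
  import Data.Integer.Properties as ℤP
  open import Data.Integer.DivMod using (_/_; _%_; a≡a%n+[a/n]*n; n%d<d)
  open import Data.Product using (∃-syntax; _×_; _,_; proj₁; proj₂)
  open import Data.Empty using (⊥-elim)
  open import Relation.Nullary using (yes; no)
  open import Relation.Binary.PropositionalEquality
  open import Data.Integer.Tactic.RingSolver using (solve-∀)
  import Data.Nat.Tactic.RingSolver as ℕ-Solver

  balanced-residue : ∀ s a → ∃[ A ] ∃[ k ] a ≡ A + + suc (s ℕ.+ s) * k × ∣ A ∣ ℕ.≤ s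
  balanced-residue s a with a % M ℕ.≤? s
    where M = + suc (s ℕ.+ s)
  ... | yes r≤s = + (a % M) , a / M , trans (a≡a%n+[a/n]*n a M) (comm (+ (a % M)) (a / M) M) , r≤s
    where
    M = + suc (s ℕ.+ s)
    comm : ∀ r q M → r + q * M ≡ r + M * q
    comm = solve-∀
  ... | no r≰s = - + (m ℕ.∸ r) , a / M + + 1 , a≡ , ∣-r∣≤s
    where
    m = suc (s ℕ.+ s)
    M = + m
    r = a % M
    m∸r≡ : + (m ℕ.∸ r) ≡ M - + r
    m∸r≡ = sym (trans (ℤP.m-n≡m⊖n m r) (ℤP.⊖-≥ (ℕP.<⇒≤ (n%d<d a M))))
    a≡ : a ≡ - + (m ℕ.∸ r) + M * (a / M + + 1)
    a≡ = trans (a≡a%n+[a/n]*n a M)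
        (trans (shift (+ r) (a / M) M) (cong (λ x → - x + M * (a / M + + 1)) (sym m∸r≡)))
      where
      shift : ∀ r q M → r + q * M ≡ - (M - r) + M * (q + + 1)
      shift = solve-∀
    ∣-r∣≤s : ∣ - + (m ℕ.∸ r) ∣ ℕ.≤ s
    ∣-r∣≤s = subst (ℕ._≤ s) (sym (ℤP.∣-i∣≡∣i∣ (+ (m ℕ.∸ r))))
      (ℕP.≤-trans (ℕP.∸-monoʳ-≤ m (ℕP.≰⇒> r≰s)) (ℕP.≤-reflexive (ℕP.m+n∸m≡n s s)))

  sumSq₄-shift : ∀ m A B C D ka kb kc kd →
    sumSq₄ (A + m * ka) (B + m * kb) (C + m * kc) (D + m * kd)
      ≡ sumSq₄ A B C D + m * (ka * (+ 2 * A + m * ka) + kb * (+ 2 * B + m * kb)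
                             + kc * (+ 2 * C + m * kc) + kd * (+ 2 * D + m * kd))
  sumSq₄-shift = identity
    where
    identity : ∀ m A B C D ka kb kc kd →
      (A + m * ka) * (A + m * ka) + (B + m * kb) * (B + m * kb) + (C + m * kc) * (C + m * kc) + (D + m * kd) * (D + m * kd)
        ≡ A * A + B * B + C * C + D * D + m * (ka * (+ 2 * A + m * ka) + kb * (+ 2 * B + m * kb)
                                              + kc * (+ 2 * C + m * kc) + kd * (+ 2 * D + m * kd))
    identity = solve-∀

  sumSq₄-scale : ∀ m a b c d → sumSq₄ (m * a) (m * b) (m * c) (m * d) ≡ m * (m * sumSq₄ a b c d)
  sumSq₄-scale = identity
    where
    identity : ∀ m a b c d →
      m * a * (m * a) + m * b * (m * b) + m * c * (m * c) + m * d * (m * d) ≡ m * (m * (a * a + b * b + c * c + d * d))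
    identity = solve-∀

  -- In Euler's identity for (A + m ka, …) and (A, …) each of the four squared terms is a multiple of m.
  euler-quotient : ∀ m r A B C D ka kb kc kd → sumSq₄ A B C D ≡ m * r →
    sumSq₄ (A + m * ka) (B + m * kb) (C + m * kc) (D + m * kd) * sumSq₄ A B C D
      ≡ m * (m * sumSq₄ (r + (ka * A + kb * B + kc * C + kd * D)) (ka * B - kb * A + kc * D - kd * C)
                        (ka * C - kb * D - kc * A + kd * B) (ka * D + kb * C - kc * B - kd * A))
  euler-quotient m r A B C D ka kb kc kd sumSq≡m*r = begin
    sumSq₄ a b c d * sumSq₄ A B C D
      ≡⟨ euler-four-square-identity a b c d A B C D ⟩
    sumSq₄ (a * A + b * B + c * C + d * D) (a * B - b * A + c * D - d * C)
           (a * C - b * D - c * A + d * B) (a * D + b * C - c * B - d * A)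
      ≡⟨ cong₂ (λ x y → sumSq₄ x y (a * C - b * D - c * A + d * B) (a * D + b * C - c * B - d * A)) X₁≡ (X₂≡ A B C D ka kb kc kd m) ⟩
    sumSq₄ (m * Y₁) (m * Y₂) (a * C - b * D - c * A + d * B) (a * D + b * C - c * B - d * A)
      ≡⟨ cong₂ (λ x y → sumSq₄ (m * Y₁) (m * Y₂) x y) (X₃≡ A B C D ka kb kc kd m) (X₄≡ A B C D ka kb kc kd m) ⟩
    sumSq₄ (m * Y₁) (m * Y₂) (m * Y₃) (m * Y₄)
      ≡⟨ sumSq₄-scale m Y₁ Y₂ Y₃ Y₄ ⟩
    m * (m * sumSq₄ Y₁ Y₂ Y₃ Y₄) ∎
    where
    open ≡-Reasoning
    a = A + m * ka ; b = B + m * kb ; c = C + m * kc ; d = D + m * kd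
    Y₁ = r + (ka * A + kb * B + kc * C + kd * D)
    Y₂ = ka * B - kb * A + kc * D - kd * C
    Y₃ = ka * C - kb * D - kc * A + kd * B
    Y₄ = ka * D + kb * C - kc * B - kd * A
    X₁-expand : ∀ A B C D ka kb kc kd m →
      (A + m * ka) * A + (B + m * kb) * B + (C + m * kc) * C + (D + m * kd) * D
        ≡ (A * A + B * B + C * C + D * D) + m * (ka * A + kb * B + kc * C + kd * D)
    X₁-expand = solve-∀
    X₁≡ : a * A + b * B + c * C + d * D ≡ m * Y₁
    X₁≡ = begin
      a * A + b * B + c * C + d * D            ≡⟨ X₁-expand A B C D ka kb kc kd m ⟩
      sumSq₄ A B C D + m * (ka * A + kb * B + kc * C + kd * D)
                                               ≡⟨ cong (_+ m * (ka * A + kb * B + kc * C + kd * D)) sumSq≡m*r ⟩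
      m * r + m * (ka * A + kb * B + kc * C + kd * D) ≡⟨ sym (ℤP.*-distribˡ-+ m r _) ⟩
      m * Y₁                                   ∎
    X₂≡ : ∀ A B C D ka kb kc kd m →
      (A + m * ka) * B - (B + m * kb) * A + (C + m * kc) * D - (D + m * kd) * C ≡ m * (ka * B - kb * A + kc * D - kd * C)
    X₂≡ = solve-∀
    X₃≡ : ∀ A B C D ka kb kc kd m →
      (A + m * ka) * C - (B + m * kb) * D - (C + m * kc) * A + (D + m * kd) * B ≡ m * (ka * C - kb * D - kc * A + kd * B)
    X₃≡ = solve-∀
    X₄≡ : ∀ A B C D ka kb kc kd m →
      (A + m * ka) * D + (B + m * kb) * C - (C + m * kc) * B - (D + m * kd) * A ≡ m * (ka * D + kb * C - kc * B - kd * A)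
    X₄≡ = solve-∀

  multiple-part : ∀ M P S T → M * P ≡ S + M * T → S ≡ M * (P - T)
  multiple-part M P S T eq = begin
    S                  ≡⟨ isolate S M T ⟩
    (S + M * T) - M * T ≡⟨ cong (λ x → x - M * T) (sym eq) ⟩
    M * P - M * T      ≡⟨ factor M P T ⟩
    M * (P - T)        ∎
    where
    open ≡-Reasoning
    isolate : ∀ S M T → S ≡ (S + M * T) - M * T
    isolate = solve-∀
    factor : ∀ M P T → M * P - M * T ≡ M * (P - T)
    factor = solve-∀

  nonNegative-factor : ∀ k R n → + suc k * R ≡ + n → ∃[ r ] R ≡ + r
  nonNegative-factor k (+ r)    n _  = r , refl
  nonNegative-factor k -[1+ j ] n ()

  sumSqℕ₄≡0 : ∀ a b c d → sumSqℕ₄ a b c d ≡ 0 → a ≡ 0 × b ≡ 0 × c ≡ 0 × d ≡ 0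
  sumSqℕ₄≡0 zero    zero    zero    zero    _ = refl , refl , refl , refl
  sumSqℕ₄≡0 zero    zero    zero    (suc d) ()
  sumSqℕ₄≡0 zero    zero    (suc c) d       ()
  sumSqℕ₄≡0 zero    (suc b) c       d       ()
  sumSqℕ₄≡0 (suc a) b       c       d       ()

  sumSqℕ₄-< : ∀ {a b c d} s → a ℕ.≤ s → b ℕ.≤ s → c ℕ.≤ s → d ℕ.≤ s →
    sumSqℕ₄ a b c d ℕ.< suc (s ℕ.+ s) ℕ.* suc (s ℕ.+ s)
  sumSqℕ₄-< s a≤s b≤s c≤s d≤s = ℕP.≤-<-trans
    (ℕP.+-mono-≤ (ℕP.+-mono-≤ (ℕP.+-mono-≤ (sq-mono a≤s) (sq-mono b≤s)) (sq-mono c≤s)) (sq-mono d≤s))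
    (subst (sumSqℕ₄ s s s s ℕ.<_) (sym (square-expand s)) (s≤s (ℕP.m≤m+n _ _)))
    where
    sq-mono : ∀ {x} → x ℕ.≤ s → x ℕ.* x ℕ.≤ s ℕ.* s
    sq-mono x≤s = ℕP.*-mono-≤ x≤s x≤s
    square-expand : ∀ s → suc (s ℕ.+ s) ℕ.* suc (s ℕ.+ s)
                            ≡ suc (s ℕ.* s ℕ.+ s ℕ.* s ℕ.+ s ℕ.* s ℕ.+ s ℕ.* s ℕ.+ (s ℕ.+ s ℕ.+ (s ℕ.+ s)))
    square-expand = ℕ-Solver.solve-∀

  sumSq₄-cong : ∀ {a b c d a' b' c' d'} → a ≡ a' → b ≡ b' → c ≡ c' → d ≡ d' →
    sumSq₄ a b c d ≡ sumSq₄ a' b' c' d'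
  sumSq₄-cong refl refl refl refl = refl

  m*p≡sumSq-of-multiples⇒m∣p : ∀ m p ka kb kc kd .{{_ : ℕ.NonZero m}} →
    + m * + p ≡ sumSq₄ (+ m * ka) (+ m * kb) (+ m * kc) (+ m * kd) → m ∣ p
  m*p≡sumSq-of-multiples⇒m∣p m p ka kb kc kd eq = divides K (ℤP.+-injective (begin
    + p          ≡⟨ ℤP.*-cancelˡ-≡ (+ m) (+ p) (+ m * + K) m*p≡m*m*K ⟩
    + m * + K    ≡⟨ sym (ℤP.pos-* m K) ⟩
    + (m ℕ.* K)  ≡⟨ cong +_ (ℕP.*-comm m K) ⟩
    + (K ℕ.* m)  ∎))
    where
    open ≡-Reasoning
    K = sumSqℕ₄ (∣ ka ∣) (∣ kb ∣) (∣ kc ∣) (∣ kd ∣)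
    m*p≡m*m*K : + m * + p ≡ + m * (+ m * + K)
    m*p≡m*m*K = trans eq (trans (sumSq₄-scale (+ m) ka kb kc kd)
                  (cong (λ x → + m * (+ m * x)) (sumSq₄≡sumSqℕ₄-abs ka kb kc kd)))

  euler-descent : ∀ m p R A B C D ka kb kc kd .{{_ : ℕ.NonZero m}} →
    + m * + p ≡ sumSq₄ (A + + m * ka) (B + + m * kb) (C + + m * kc) (D + + m * kd) →
    sumSq₄ A B C D ≡ + m * R → IsSumOfFourSquares (+ p * R)
  euler-descent m p R A B C D ka kb kc kd m*p≡ sumSq≡m*R =
    Y₁ , Y₂ , Y₃ , Y₄ , ℤP.*-cancelˡ-≡ M _ _ (ℤP.*-cancelˡ-≡ M _ _ (begin
      M * (M * (+ p * R))              ≡⟨ sym (rearrange M (+ p) R) ⟩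
      M * + p * (M * R)                ≡⟨ cong₂ _*_ m*p≡ (sym sumSq≡m*R) ⟩
      sumSq₄ (A + M * ka) (B + M * kb) (C + M * kc) (D + M * kd) * sumSq₄ A B C D
                                       ≡⟨ euler-quotient M R A B C D ka kb kc kd sumSq≡m*R ⟩
      M * (M * sumSq₄ Y₁ Y₂ Y₃ Y₄)     ∎))
    where
    open ≡-Reasoning
    M = + m
    Y₁ = R + (ka * A + kb * B + kc * C + kd * D)
    Y₂ = ka * B - kb * A + kc * D - kd * C
    Y₃ = ka * C - kb * D - kc * A + kd * B
    Y₄ = ka * D + kb * C - kc * B - kd * A
    rearrange : ∀ M P R → M * P * (M * R) ≡ M * (M * (P * R))
    rearrange = solve-∀

  module _ {p : ℕ} (p-prime : Prime p) (t : ℕ) where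

    private
      s = suc t
      m = suc (s ℕ.+ s)
      M = + m

    -- Reducing a, b, c, d to balanced residues A, B, C, D modulo m gives A² + B² + C² + D² = m r with r < m.
    odd-descent-step : m ℕ.< p → IsSumOfFourSquares (+ (m ℕ.* p)) →
                       ∃[ r ] 1 ℕ.≤ r × r ℕ.< m × IsSumOfFourSquares (+ (r ℕ.* p))
    odd-descent-step m<p (a , b , c , d , mp≡)
      with balanced-residue s a | balanced-residue s b | balanced-residue s c | balanced-residue s d
    ... | A , ka , refl , ∣A∣≤s | B , kb , refl , ∣B∣≤s | C , kc , refl , ∣C∣≤s | D , kd , refl , ∣D∣≤s =
      conclude r R≡+r m*r≡N r<m
      where
      T = ka * (+ 2 * A + M * ka) + kb * (+ 2 * B + M * kb) + kc * (+ 2 * C + M * kc) + kd * (+ 2 * D + M * kd)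
      R = + p - T
      M*p≡ : M * + p ≡ sumSq₄ (A + M * ka) (B + M * kb) (C + M * kc) (D + M * kd)
      M*p≡ = trans (sym (ℤP.pos-* m p)) mp≡
      sumSq≡M*R : sumSq₄ A B C D ≡ M * R
      sumSq≡M*R = multiple-part M (+ p) (sumSq₄ A B C D) T (trans M*p≡ (sumSq₄-shift M A B C D ka kb kc kd))
      N = sumSqℕ₄ (∣ A ∣) (∣ B ∣) (∣ C ∣) (∣ D ∣)
      M*R≡N : M * R ≡ + N
      M*R≡N = trans (sym sumSq≡M*R) (sumSq₄≡sumSqℕ₄-abs A B C D)
      r = proj₁ (nonNegative-factor (s ℕ.+ s) R N M*R≡N)
      R≡+r = proj₂ (nonNegative-factor (s ℕ.+ s) R N M*R≡N)
      m*r≡N : m ℕ.* r ≡ N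
      m*r≡N = ℤP.+-injective (trans (ℤP.pos-* m r) (trans (cong (M *_) (sym R≡+r)) M*R≡N))
      r<m : r ℕ.< m
      r<m = ℕP.*-cancelˡ-< m r m (subst (ℕ._< m ℕ.* m) (sym m*r≡N) (sumSqℕ₄-< s ∣A∣≤s ∣B∣≤s ∣C∣≤s ∣D∣≤s))
      conclude : ∀ r → R ≡ + r → m ℕ.* r ≡ N → r ℕ.< m →
                 ∃[ r ] 1 ℕ.≤ r × r ℕ.< m × IsSumOfFourSquares (+ (r ℕ.* p))
      conclude zero _ m*0≡N _ =
        ⊥-elim (Prime.notComposite p-prime (composite m<p (m*p≡sumSq-of-multiples⇒m∣p m p ka kb kc kd
          (trans M*p≡ (sumSq₄-cong (drop A ka ∣A∣≡0) (drop B kb ∣B∣≡0) (drop C kc ∣C∣≡0) (drop D kd ∣D∣≡0))))))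
        where
        all-zero = sumSqℕ₄≡0 (∣ A ∣) (∣ B ∣) (∣ C ∣) (∣ D ∣) (trans (sym m*0≡N) (ℕP.*-zeroʳ m))
        ∣A∣≡0 = proj₁ all-zero
        ∣B∣≡0 = proj₁ (proj₂ all-zero)
        ∣C∣≡0 = proj₁ (proj₂ (proj₂ all-zero))
        ∣D∣≡0 = proj₂ (proj₂ (proj₂ all-zero))
        drop : ∀ X k → ∣ X ∣ ≡ 0 → X + M * k ≡ M * k
        drop X k ∣X∣≡0 = trans (cong (_+ M * k) (ℤP.∣i∣≡0⇒i≡0 {X} ∣X∣≡0)) (ℤP.+-identityˡ (M * k))
      conclude (suc r′) R≡ _ r<m = suc r′ , s≤s z≤n , r<m ,
        subst IsSumOfFourSquares (trans (cong (+ p *_) R≡) (trans (ℤP.*-comm (+ p) (+ suc r′)) (sym (ℤP.pos-* (suc r′) p))))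
          (euler-descent m p R A B C D ka kb kc kd M*p≡ sumSq≡M*R)


module LagrangeFourSquare where

  open FourSquares
  open FourSquareDescent
  open import Data.Nat as ℕ using (ℕ; zero; suc; z≤n; s≤s; _+_; _*_; _∸_; _≤_; _<_; _≤?_)
  import Data.Nat.Properties as ℕP
  open import Data.Nat.Divisibility using (_∣_; divides; ∣m+n∣m⇒∣n; n∣m*n; ∣⇒≤; quotient-<)
  open import Data.Nat.DivMod using (_%_; _/_; m≡m%n+[m/n]*n; m%n<n)
  open import Data.Nat.Primality using (Prime; composite; prime?; ¬prime⇒composite; ¬prime[0]; ¬prime[1]; euclidsLemma)
  open import Data.Nat.Induction using (<-wellFounded)
  open import Induction.WellFounded using (Acc; acc)
  open import Data.Fin using (toℕ; fromℕ<)
  open import Data.Vec using (Vec; []; _∷_)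
  import Data.Fin.Properties as FinP
  open import Data.Integer as ℤ using (ℤ; +_)
  import Data.Integer.Properties as ℤP
  open import Data.Product using (∃-syntax; _×_; _,_)
  open import Data.Sum using (_⊎_; inj₁; inj₂; [_,_]′)
  open import Data.Empty using (⊥-elim)
  open import Relation.Nullary using (¬_; Dec; yes; no)
  open import Relation.Binary.PropositionalEquality
  open import Function using (_∘_)
  import Data.Nat.Tactic.RingSolver as ℕ-Solver

  affineSq : ℕ → ℕ → ℕ → ℕ
  affineSq c k n = c * (k + n * n)

  module _ (h : ℕ) (p-prime : Prime (suc (suc h + suc h))) where

    private
      H = suc h
      p = suc (H + H)

    ∤-small : ∀ {n} → 1 ≤ n → n < p → ¬ p ∣ n
    ∤-small {suc n} _ n<p p∣n = ℕP.<⇒≱ n<p (∣⇒≤ p∣n)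

    %-≡⇒+quotients-≡ : ∀ a b → a % p ≡ b % p → a + (b / p) * p ≡ b + (a / p) * p
    %-≡⇒+quotients-≡ a b eq = begin
      a + (b / p) * p                   ≡⟨ cong (_+ (b / p) * p) (m≡m%n+[m/n]*n a p) ⟩
      (a % p + (a / p) * p) + (b / p) * p ≡⟨ cong (λ z → (z + (a / p) * p) + (b / p) * p) eq ⟩
      (b % p + (a / p) * p) + (b / p) * p ≡⟨ swap (b % p) _ _ ⟩
      (b % p + (b / p) * p) + (a / p) * p ≡⟨ cong (_+ (a / p) * p) (sym (m≡m%n+[m/n]*n b p)) ⟩
      b + (a / p) * p                   ∎
      where
      open ≡-Reasoning
      swap : ∀ u v w → (u + v) + w ≡ (u + w) + v
      swap = ℕ-Solver.solve-∀

    -- The prime p divides the difference c e (x + x + e) but none of its factors, as 1 ≤ e ≤ x + x + e < p.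
    affineSq-injective-mod : ∀ c k x e → ¬ p ∣ c → 1 ≤ e → x + e ≤ H →
      affineSq c k x % p ≢ affineSq c k (x + e) % p
    affineSq-injective-mod c k x e p∤c 1≤e x+e≤H eq =
      [ p∤c , [ ∤-small 1≤e e<p , ∤-small (ℕP.≤-trans 1≤e (ℕP.m≤n+m e (x + x))) x+x+e<p ]′
            ∘ euclidsLemma e (x + x + e) p-prime ]′
        (euclidsLemma c (e * (x + x + e)) p-prime p∣difference)
      where
      Qa = affineSq c k (x + e) / p
      Qb = affineSq c k x / p
      expand : ∀ c k x e q → c * (k + (x + e) * (x + e)) + q ≡ c * (k + x * x) + (c * (e * (x + x + e)) + q)
      expand = ℕ-Solver.solve-∀
      Qa*p≡ : Qa * p ≡ c * (e * (x + x + e)) + Qb * p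
      Qa*p≡ = ℕP.+-cancelˡ-≡ (affineSq c k x) _ _
                (trans (%-≡⇒+quotients-≡ (affineSq c k x) (affineSq c k (x + e)) eq) (expand c k x e (Qb * p)))
      p∣difference : p ∣ c * (e * (x + x + e))
      p∣difference = ∣m+n∣m⇒∣n (divides Qa (trans (ℕP.+-comm (Qb * p) _) (sym Qa*p≡))) (n∣m*n Qb)
      e<p : e < p
      e<p = s≤s (ℕP.≤-trans (ℕP.≤-trans (ℕP.m≤n+m e x) x+e≤H) (ℕP.m≤m+n H H))
      x+x+e<p : x + x + e < p
      x+x+e<p = s≤s (ℕP.≤-trans (ℕP.≤-reflexive (ℕP.+-assoc x x e))
                                (ℕP.+-mono-≤ (ℕP.≤-trans (ℕP.m≤m+n x e) x+e≤H) x+e≤H))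

    affineSq-distinct-mod : ∀ c k u v → ¬ p ∣ c → u < v → v ≤ H → affineSq c k u % p ≢ affineSq c k v % p
    affineSq-distinct-mod c k u v p∤c u<v v≤H eq =
      affineSq-injective-mod c k u (v ∸ u) p∤c (ℕP.m<n⇒0<n∸m u<v) (subst (_≤ H) (sym u+[v∸u]≡v) v≤H)
        (subst (λ z → affineSq c k u % p ≡ affineSq c k z % p) (sym u+[v∸u]≡v) eq)
      where u+[v∸u]≡v = ℕP.m+[n∸m]≡n (ℕP.<⇒≤ u<v)

    -- (p - 1) (1 + y²) ≡ -(1 + y²) modulo p
    square≡-1-square⇒∣ : ∀ x y → affineSq 1 0 x % p ≡ affineSq (H + H) 1 y % p → p ∣ x * x + y * y + 1
    square≡-1-square⇒∣ x y eq = ∣m+n∣m⇒∣n (divides (1 + y * y + Qa) Qb*p+x²+y²+1≡) (n∣m*n Qb)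
      where
      Qa = affineSq 1 0 x / p
      Qb = affineSq (H + H) 1 y / p
      move : ∀ x y Qb → Qb + (x * x + y * y + 1) ≡ (1 * (0 + x * x) + Qb) + (1 + y * y)
      move = ℕ-Solver.solve-∀
      factor : ∀ p' y Qa → (p' * (1 + y * y) + Qa * suc p') + (1 + y * y) ≡ (1 + y * y + Qa) * suc p'
      factor = ℕ-Solver.solve-∀
      Qb*p+x²+y²+1≡ : Qb * p + (x * x + y * y + 1) ≡ (1 + y * y + Qa) * p
      Qb*p+x²+y²+1≡ = trans (move x y (Qb * p))
        (trans (cong (_+ (1 + y * y)) (%-≡⇒+quotients-≡ (affineSq 1 0 x) (affineSq (H + H) 1 y) eq))
               (factor (H + H) y Qa))

    private
      candidate : ℕ → ℕ
      candidate n with n ≤? H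
      ... | yes _ = affineSq 1 0 n
      ... | no  _ = affineSq (H + H) 1 (n ∸ suc H)
      candidate-low : ∀ n → n ≤ H → candidate n ≡ affineSq 1 0 n
      candidate-low n n≤H with n ≤? H
      ... | yes _   = refl
      ... | no  n≰H = ⊥-elim (n≰H n≤H)
      candidate-high : ∀ n → ¬ n ≤ H → candidate n ≡ affineSq (H + H) 1 (n ∸ suc H)
      candidate-high n n≰H with n ≤? H
      ... | yes n≤H = ⊥-elim (n≰H n≤H)
      ... | no  _   = refl
      high≤H : ∀ b → b < suc p → b ∸ suc H ≤ H
      high≤H b (s≤s b≤p) = ℕP.≤-trans (ℕP.∸-monoˡ-≤ (suc H) b≤p) (ℕP.≤-reflexive (ℕP.m+n∸m≡n H H))

    -- The p + 1 numbers x² and -(1 + y²) for x, y ≤ H cannot be pairwise distinct modulo p.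
    ∃x²+y²+1≡0-mod : ∃[ x ] ∃[ y ] x ≤ H × y ≤ H × p ∣ x * x + y * y + 1
    ∃x²+y²+1≡0-mod with FinP.pigeonhole (ℕP.n<1+n p) (λ i → fromℕ< (m%n<n (candidate (toℕ i)) p))
    ... | i , j , i<j , eq = collision (toℕ i) (toℕ j) i<j (FinP.toℕ<n j)
            (trans (sym (FinP.toℕ-fromℕ< (m%n<n (candidate (toℕ i)) p)))
              (trans (cong toℕ eq) (FinP.toℕ-fromℕ< (m%n<n (candidate (toℕ j)) p))))
      where
      p∤1 : ¬ p ∣ 1
      p∤1 = ∤-small (s≤s z≤n) (s≤s (s≤s z≤n))
      p∤p-1 : ¬ p ∣ H + H
      p∤p-1 = ∤-small (s≤s z≤n) (ℕP.n<1+n (H + H))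
      collision : ∀ a b → a < b → b < suc p → candidate a % p ≡ candidate b % p →
                  ∃[ x ] ∃[ y ] x ≤ H × y ≤ H × p ∣ x * x + y * y + 1
      collision a b a<b b<p+1 eq = by-cases (a ≤? H) (b ≤? H)
       where
       by-cases : Dec (a ≤ H) → Dec (b ≤ H) → ∃[ x ] ∃[ y ] x ≤ H × y ≤ H × p ∣ x * x + y * y + 1
       by-cases (yes a≤H) (yes b≤H) = ⊥-elim (affineSq-distinct-mod 1 0 a b p∤1 a<b b≤H
              (trans (cong (_% p) (sym (candidate-low a a≤H))) (trans eq (cong (_% p) (candidate-low b b≤H)))))
       by-cases (yes a≤H) (no b≰H) = a , b ∸ suc H , a≤H , high≤H b b<p+1 , square≡-1-square⇒∣ a (b ∸ suc H)
              (trans (cong (_% p) (sym (candidate-low a a≤H))) (trans eq (cong (_% p) (candidate-high b b≰H))))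
       by-cases (no a≰H) (yes b≤H) = ⊥-elim (a≰H (ℕP.≤-trans (ℕP.<⇒≤ a<b) b≤H))
       by-cases (no a≰H) (no b≰H) = ⊥-elim (affineSq-distinct-mod (H + H) 1 (a ∸ suc H) (b ∸ suc H) p∤p-1
              (ℕP.∸-monoˡ-< a<b (ℕP.≰⇒> a≰H)) (high≤H b b<p+1)
              (trans (cong (_% p) (sym (candidate-high a a≰H))) (trans eq (cong (_% p) (candidate-high b b≰H)))))

    -- The multiple is below p because x² + y² + 1 ≤ 2H² + 1 < p².
    small-multiple-isSumOfFourSquares : ∃[ m ] 1 ≤ m × m < p × IsSumOfFourSquares (+ (m * p))
    small-multiple-isSumOfFourSquares with ∃x²+y²+1≡0-mod
    ... | x , y , x≤H , y≤H , divides q x²+y²+1≡q*p = q , 1≤q q x²+y²+1≡q*p , q<p ,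
          + x , + y , + 1 , + 0 , sym (trans (sumSq₄≡sumSqℕ₄-abs (+ x) (+ y) (+ 1) (+ 0)) (cong +_ (trans (drop-squares x y) x²+y²+1≡q*p)))
      where
      X = x * x + y * y + 1
      drop-squares : ∀ x y → x * x + y * y + 1 * 1 + 0 * 0 ≡ x * x + y * y + 1
      drop-squares = ℕ-Solver.solve-∀
      1≤q : ∀ q → X ≡ q * p → 1 ≤ q
      1≤q (suc _) _ = s≤s z≤n
      1≤q zero  X≡0 = ⊥-elim (ℕP.1+n≢0 (trans (ℕP.+-comm 1 (x * x + y * y)) X≡0))
      X≤ : X ≤ H * H + H * H + 1
      X≤ = ℕP.+-monoˡ-≤ 1 (ℕP.+-mono-≤ (ℕP.*-mono-≤ x≤H x≤H) (ℕP.*-mono-≤ y≤H y≤H))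
      p² : ∀ H → suc (H + H) * suc (H + H) ≡ (H * H + H * H + 1) + (H * H + H * H + H + H + H + H)
      p² = ℕ-Solver.solve-∀
      q<p : q < p
      q<p = ℕP.*-cancelˡ-< p q p (ℕP.≤-<-trans (ℕP.≤-reflexive (trans (ℕP.*-comm p q) (sym x²+y²+1≡q*p)))
              (ℕP.<-≤-trans (ℕP.m<m+n X (ℕP.≤-trans (s≤s z≤n) (ℕP.m≤n+m H (H * H + H * H + H + H + H))))
                (ℕP.≤-trans (ℕP.+-monoˡ-≤ _ X≤) (ℕP.≤-reflexive (sym (p² H))))))

  even-or-odd : ∀ n → (∃[ h ] n ≡ h + h) ⊎ (∃[ h ] n ≡ suc (h + h))
  even-or-odd zero = inj₁ (0 , refl)
  even-or-odd (suc n) with even-or-odd n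
  ... | inj₁ (h , n≡h+h)   = inj₂ (h , cong suc n≡h+h)
  ... | inj₂ (h , n≡1+h+h) = inj₁ (suc h , cong suc (trans n≡1+h+h (sym (ℕP.+-suc h h))))

  -- Euler's descent: an even multiple halves, an odd multiple m ≥ 3 shrinks by odd-descent-step.
  descent : ∀ {p} → Prime p → ∀ m → Acc _<_ m → 1 ≤ m → m < p →
            IsSumOfFourSquares (+ (m * p)) → IsSumOfFourSquares (+ p)
  descent {p} p-prime m (acc smaller) 1≤m m<p m*p-sq with even-or-odd m
  ... | inj₁ (zero , refl) = ⊥-elim (ℕP.<-irrefl refl 1≤m)
  ... | inj₁ (suc h , refl) =
    descent p-prime (suc h) (smaller h<m) (s≤s z≤n) (ℕP.<-trans h<m m<p)
      (half-isSumOfFourSquares (+ (suc h * p)) (subst IsSumOfFourSquares 2*[h*p]≡ m*p-sq))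
    where
    h<m : suc h < suc h + suc h
    h<m = s≤s (ℕP.m≤n+m (suc h) h)
    double : ∀ h p → (h + h) * p ≡ 2 * (h * p)
    double = ℕ-Solver.solve-∀
    2*[h*p]≡ : + ((suc h + suc h) * p) ≡ + 2 ℤ.* + (suc h * p)
    2*[h*p]≡ = trans (cong +_ (double (suc h) p)) (ℤP.pos-* 2 (suc h * p))
  ... | inj₂ (zero , refl) = subst IsSumOfFourSquares (cong +_ (ℕP.*-identityˡ p)) m*p-sq
  ... | inj₂ (suc t , refl) with odd-descent-step p-prime t m<p m*p-sq
  ...   | r , 1≤r , r<m , r*p-sq = descent p-prime r (smaller r<m) 1≤r (ℕP.<-trans r<m m<p) r*p-sq

  prime-isSumOfFourSquares : ∀ {p} → Prime p → IsSumOfFourSquares (+ p)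
  prime-isSumOfFourSquares {p} p-prime with even-or-odd p
  ... | inj₁ (zero , refl)        = ⊥-elim (¬prime[0] p-prime)
  ... | inj₁ (suc zero , refl)    = + 1 , + 1 , + 0 , + 0 , refl
  ... | inj₁ (suc (suc h) , refl) = ⊥-elim (Prime.notComposite p-prime (composite 2<p 2∣p))
    where
    2<p : 2 < suc (suc h) + suc (suc h)
    2<p = s≤s (s≤s (ℕP.≤-trans (s≤s z≤n) (ℕP.m≤n+m (suc (suc h)) h)))
    2∣p : 2 ∣ suc (suc h) + suc (suc h)
    2∣p = divides (suc (suc h)) (trans (cong (λ x → suc (suc h) + x) (sym (ℕP.+-identityʳ (suc (suc h)))))
                                       (ℕP.*-comm 2 (suc (suc h))))
  ... | inj₂ (zero , refl)        = ⊥-elim (¬prime[1] p-prime)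
  ... | inj₂ (suc h , refl) = descend (small-multiple-isSumOfFourSquares h p-prime)
    where
    descend : ∃[ m ] 1 ≤ m × m < p × IsSumOfFourSquares (+ (m * p)) → IsSumOfFourSquares (+ p)
    descend (m , 1≤m , m<p , m*p-sq) = descent p-prime m (<-wellFounded m) 1≤m m<p m*p-sq

  lagrange-four-square : ∀ n → IsSumOfFourSquares (+ n)
  lagrange-four-square n = go n (<-wellFounded n)
    where
    go : ∀ n → Acc _<_ n → IsSumOfFourSquares (+ n)
    go zero          _ = + 0 , + 0 , + 0 , + 0 , refl
    go (suc zero)    _ = + 1 , + 0 , + 0 , + 0 , refl
    go (suc (suc k)) (acc smaller) with prime? (suc (suc k))
    ... | yes n-prime = prime-isSumOfFourSquares n-prime
    ... | no ¬n-prime with ¬prime⇒composite ¬n-prime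
    ...   | composite {d} d<n (divides q n≡q*d) =
      subst IsSumOfFourSquares (trans (sym (ℤP.pos-* q d)) (cong +_ (sym n≡q*d)))
        (*-isSumOfFourSquares (go q (smaller (quotient-< (divides q n≡q*d)))) (go d (smaller d<n)))

  fourSquares : ℕ → Vec ℤ 4
  fourSquares n = let a , b , c , d , _ = lagrange-four-square n in a ∷ b ∷ c ∷ d ∷ []

  sumSqVec-fourSquares : ∀ n → sumSqVec (fourSquares n) ≡ + n
  sumSqVec-fourSquares n = let _ , _ , _ , _ , n≡ = lagrange-four-square n in sym n≡

  normSq-fourSquares : ∀ n → normSq (fourSquares n) ≡ n
  normSq-fourSquares n = ℤP.+-injective (trans (sym (sumSqVec≡normSq (fourSquares n))) (sumSqVec-fourSquares n))


module SolutionCounting where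

  open import Defs
  open Preliminaries
  open import Data.Nat as ℕ using (ℕ; _≤_)
  open import Data.Integer using (ℤ)
  import Data.Integer.Properties as ℤP
  open import Data.Vec using (Vec)
  import Data.Vec.Properties as VecP
  open import Data.List using (List; length; filter; deduplicate)
  open import Data.List.Membership.Propositional using (_∈_)
  import Data.List.Membership.Propositional.Properties as ∈P
  open import Data.List.Relation.Unary.All as All using (All; all?)
  open import Data.List.Relation.Unary.Unique.Propositional using (Unique)
  import Data.List.Relation.Unary.Unique.DecPropositional.Properties as UniqueP
  open import Data.Product using (Σ; _,_; proj₂)
  open import Relation.Nullary using (Dec)
  open import Relation.Binary.PropositionalEquality

  sat? : ∀ {n} (x : Vec ℤ n) (e : Eqn n) → Dec (Sat x e)
  sat? x (one i)     = _ ℤP.≟ _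
  sat? x (add i j k) = _ ℤP.≟ _
  sat? x (mul i j k) = _ ℤP.≟ _

  solution? : ∀ {n} (S : System n) (x : Vec ℤ n) → Dec (Solution S x)
  solution? S x = all? (sat? x) S

  cover⇒hasExactlySolutions : ∀ {n} (S : System n) (L : List (Vec ℤ n)) →
    (∀ x → Solution S x → x ∈ L) → Σ ℕ (HasExactlySolutions S)
  cover⇒hasExactlySolutions S L covers =
    length D , D , UniqueP.deduplicate-! _≟_ solutions , refl , complete , All.tabulate sound
    where
    _≟_ = VecP.≡-dec ℤP._≟_
    solutions = filter (solution? S) L
    D = deduplicate _≟_ solutions
    complete : ∀ x → Solution S x → x ∈ D
    complete x sol = ∈P.∈-deduplicate⁺ _≟_ (∈P.∈-filter⁺ (solution? S) (covers x sol) sol)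
    sound : ∀ {x} → x ∈ D → Solution S x
    sound x∈D = proj₂ (∈P.∈-filter⁻ (solution? S) {xs = L} (∈P.∈-deduplicate⁻ _≟_ solutions x∈D))

  unique-solutions-≤ : ∀ {n} (S : System n) {c} (U : List (Vec ℤ n)) →
    HasExactlySolutions S c → Unique U → All (Solution S) U → length U ≤ c
  unique-solutions-≤ S U (L , _ , refl , complete , _) uniq sols =
    unique-⊆⇒length-≤ U L uniq (λ {x} x∈U → complete x (All.lookup sols x∈U))


module GreatestSolutionCount where

  open import Defs
  open Preliminaries
  open SolutionCounting
  open import Level using (0ℓ)
  open import Data.Nat as ℕ using (ℕ; zero; suc; z≤n; s≤s; _≤_; _+_)
  import Data.Nat.Properties as ℕP
  open import Data.Integer using (ℤ; +_)
  open import Data.Fin using (Fin)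
  import Data.Fin.Properties as FinP
  open import Data.Vec as Vec using (Vec; lookup)
  import Data.Vec.Properties as VecP
  open import Data.List as List using (List; []; _∷_; length; filter; allFin; map; _++_; cartesianProduct)
  open import Data.List.Membership.Propositional using (_∈_)
  import Data.List.Membership.Propositional.Properties as ∈P
  open import Data.List.Relation.Unary.Any using (here; there)
  open import Data.List.Relation.Unary.All as All using (All; _∷_; [])
  open import Data.List.Relation.Unary.AllPairs using ([]; _∷_)
  open import Data.Product using (Σ; ∃-syntax; _×_; _,_; proj₂)
  open import Data.Sum using (inj₁; inj₂)
  open import Data.Empty using (⊥-elim)
  open import Effect.Monad using (RawMonad)
  open import Relation.Nullary using (¬_; Dec; yes; no)
  open import Relation.Nullary.Negation using (¬¬-Monad)
  open import Relation.Nullary.Decidable using (¬¬-excluded-middle)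
  open import Relation.Unary using (Decidable)
  open import Relation.Binary.PropositionalEquality
  open import Relation.Binary.Definitions using (DecidableEquality)

  open RawMonad (¬¬-Monad {0ℓ})

  triples : ∀ n → List (Fin n × Fin n × Fin n)
  triples n = cartesianProduct (allFin n) (cartesianProduct (allFin n) (allFin n))

  ∈-triples : ∀ {n} (i j k : Fin n) → (i , j , k) ∈ triples n
  ∈-triples i j k = ∈P.∈-cartesianProduct⁺ (∈P.∈-allFin i) (∈P.∈-cartesianProduct⁺ (∈P.∈-allFin j) (∈P.∈-allFin k))

  uncurry₃ : ∀ {n} → (Fin n → Fin n → Fin n → Eqn n) → Fin n × Fin n × Fin n → Eqn n
  uncurry₃ f (i , j , k) = f i j k

  allEqns : ∀ n → List (Eqn n)
  allEqns n = map one (allFin n) ++ map (uncurry₃ add) (triples n) ++ map (uncurry₃ mul) (triples n)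

  ∈-allEqns : ∀ {n} (e : Eqn n) → e ∈ allEqns n
  ∈-allEqns (one i)     = ∈P.∈-++⁺ˡ (∈P.∈-map⁺ one (∈P.∈-allFin i))
  ∈-allEqns {n} (add i j k) =
    ∈P.∈-++⁺ʳ (map one (allFin n)) (∈P.∈-++⁺ˡ (∈P.∈-map⁺ (uncurry₃ add) (∈-triples i j k)))
  ∈-allEqns {n} (mul i j k) =
    ∈P.∈-++⁺ʳ (map one (allFin n)) (∈P.∈-++⁺ʳ (map (uncurry₃ add) (triples n)) (∈P.∈-map⁺ (uncurry₃ mul) (∈-triples i j k)))

  _≟ₑ_ : ∀ {n} → DecidableEquality (Eqn n)
  one i ≟ₑ one i′ with i FinP.≟ i′
  ... | yes refl = yes refl
  ... | no i≢i′  = no λ { refl → i≢i′ refl }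
  add i j k ≟ₑ add i′ j′ k′ with i FinP.≟ i′ | j FinP.≟ j′ | k FinP.≟ k′
  ... | yes refl | yes refl | yes refl = yes refl
  ... | no i≢i′  | _        | _        = no λ { refl → i≢i′ refl }
  ... | yes _    | no j≢j′  | _        = no λ { refl → j≢j′ refl }
  ... | yes _    | yes _    | no k≢k′  = no λ { refl → k≢k′ refl }
  mul i j k ≟ₑ mul i′ j′ k′ with i FinP.≟ i′ | j FinP.≟ j′ | k FinP.≟ k′
  ... | yes refl | yes refl | yes refl = yes refl
  ... | no i≢i′  | _        | _        = no λ { refl → i≢i′ refl }
  ... | yes _    | no j≢j′  | _        = no λ { refl → j≢j′ refl }
  ... | yes _    | yes _    | no k≢k′  = no λ { refl → k≢k′ refl }
  one _     ≟ₑ add _ _ _ = no λ ()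
  one _     ≟ₑ mul _ _ _ = no λ ()
  add _ _ _ ≟ₑ one _     = no λ ()
  add _ _ _ ≟ₑ mul _ _ _ = no λ ()
  mul _ _ _ ≟ₑ one _     = no λ ()
  mul _ _ _ ≟ₑ add _ _ _ = no λ ()

  sublists : ∀ {A : Set} → List A → List (List A)
  sublists []       = [] ∷ []
  sublists (x ∷ xs) = sublists xs ++ map (x ∷_) (sublists xs)

  filter-∈-sublists : ∀ {A : Set} {P : A → Set} (P? : Decidable P) xs → filter P? xs ∈ sublists xs
  filter-∈-sublists P? [] = here refl
  filter-∈-sublists P? (x ∷ xs) with P? x
  ... | yes _ = ∈P.∈-++⁺ʳ (sublists xs) (∈P.∈-map⁺ (x ∷_) (filter-∈-sublists P? xs))
  ... | no  _ = ∈P.∈-++⁺ˡ (filter-∈-sublists P? xs)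

  -- Every system has the same solutions as the sublist of allEqns n it contains, so up to
  -- equivalence there are only finitely many systems.
  module _ {n : ℕ} where
    open import Data.List.Membership.DecPropositional (_≟ₑ_ {n}) using (_∈?_)

    normalise : System n → System n
    normalise S = filter (_∈? S) (allEqns n)

    normalise-∈-sublists : ∀ S → normalise S ∈ sublists (allEqns n)
    normalise-∈-sublists S = filter-∈-sublists (_∈? S) (allEqns n)

    solution-normalise : ∀ S x → Solution S x → Solution (normalise S) x
    solution-normalise S x sol = All.tabulate λ e∈ → All.lookup sol (proj₂ (∈P.∈-filter⁻ (_∈? S) {xs = allEqns n} e∈))

    normalise-solution : ∀ S x → Solution (normalise S) x → Solution S x
    normalise-solution S x sol = All.tabulate λ {e} e∈S → All.lookup sol (∈P.∈-filter⁺ (_∈? S) (∈-allEqns e) e∈S)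

  HasCoverOfSize≤ : ∀ {n} → System n → ℕ → Set
  HasCoverOfSize≤ {n} S U = Σ (List (Vec ℤ n)) λ L → (∀ x → Solution S x → x ∈ L) × length L ≤ U

  ¬¬-uniform-cover-bound : ∀ {n} (Ss : List (System n)) →
    ¬ ¬ (∃[ U ] ∀ {S} → S ∈ Ss → FinitelyManySolutions S → HasCoverOfSize≤ S U)
  ¬¬-uniform-cover-bound []       = return (0 , λ ())
  ¬¬-uniform-cover-bound (S ∷ Ss) = do
    U , bound ← ¬¬-uniform-cover-bound Ss
    finite? ← ¬¬-excluded-middle
    return (extend U bound finite?)
    where
    extend : ∀ U → (∀ {S} → S ∈ Ss → FinitelyManySolutions S → HasCoverOfSize≤ S U) → Dec (FinitelyManySolutions S) →
      ∃[ U ] ∀ {S′} → S′ ∈ S ∷ Ss → FinitelyManySolutions S′ → HasCoverOfSize≤ S′ U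
    extend U bound (yes (L , covers)) = length L + U , λ where
      (here refl) _  → L , covers , ℕP.m≤m+n (length L) U
      (there S′∈) fin → let L′ , covers′ , L′≤U = bound S′∈ fin in L′ , covers′ , ℕP.≤-trans L′≤U (ℕP.m≤n+m U (length L))
    extend U bound (no infinite) = U , λ where
      (here refl) fin → ⊥-elim (infinite fin)
      (there S′∈) fin → bound S′∈ fin

  ¬¬-solutionCount-bounded : ∀ n → ¬ ¬ (∃[ U ] ∀ (S : System n) c → HasExactlySolutions S c → c ≤ U)
  ¬¬-solutionCount-bounded n = do
    U , bound ← ¬¬-uniform-cover-bound (sublists (allEqns n))
    return (U , λ S c (L , unique , length≡c , complete , sound) →
      let L′ , covers , L′≤U = bound (normalise-∈-sublists S) (L , λ x sol → complete x (normalise-solution S x sol))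
      in ℕP.≤-trans (subst (_≤ length L′) length≡c
           (unique-⊆⇒length-≤ L L′ unique λ {x} x∈L → covers x (solution-normalise S x (All.lookup sound x∈L))))
         L′≤U)

  ¬¬-maximum : (Q : ℕ → Set) → ∀ U → (∀ c → Q c → c ≤ U) → ∀ c₀ → Q c₀ → ¬ ¬ (∃[ b ] Q b × ∀ c → Q c → c ≤ b)
  ¬¬-maximum Q zero    bound c₀ q₀ = return (c₀ , q₀ , λ c qc → ℕP.≤-trans (bound c qc) z≤n)
  ¬¬-maximum Q (suc U) bound c₀ q₀ = do
    Q[1+U]? ← ¬¬-excluded-middle
    case Q[1+U]?
    where
    case : Dec (Q (suc U)) → ¬ ¬ (∃[ b ] Q b × ∀ c → Q c → c ≤ b)
    case (yes q) = return (suc U , q , bound)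
    case (no ¬q) = ¬¬-maximum Q U c≤U c₀ q₀
      where
      c≤U : ∀ c → Q c → c ≤ U
      c≤U c qc with ℕP.m≤n⇒m<n∨m≡n (bound c qc)
      ... | inj₁ (s≤s c≤U) = c≤U
      ... | inj₂ refl      = ⊥-elim (¬q qc)

  all-one-hasOneSolution : ∀ n → HasExactlySolutions (map one (allFin n)) 1
  all-one-hasOneSolution n = Vec.replicate n (+ 1) ∷ [] , [] ∷ [] , refl , complete , All.tabulate sat ∷ []
    where
    sat : ∀ {e} → e ∈ map one (allFin n) → Sat (Vec.replicate n (+ 1)) e
    sat e∈ with ∈P.∈-map⁻ one e∈
    ... | i , _ , refl = VecP.lookup-replicate i (+ 1)
    complete : ∀ x → Solution (map one (allFin n)) x → x ∈ Vec.replicate n (+ 1) ∷ []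
    complete x sol = here (lookup-ext λ i → trans (All.lookup sol (∈P.∈-map⁺ one (∈P.∈-allFin i))) (sym (VecP.lookup-replicate i (+ 1))))

  ¬¬-g-exists : ∀ n → ¬ ¬ (∃[ b ] IsG n b)
  ¬¬-g-exists n = do
    U , bound ← ¬¬-solutionCount-bounded n
    b , (S , exact) , maximal ← ¬¬-maximum (λ c → Σ (System n) λ S → HasExactlySolutions S c) U
                                   (λ c (S , exact) → bound S c exact) 1 (map one (allFin n) , all-one-hasOneSolution n)
    return (b , (S , exact) , λ S c exact → maximal c (S , exact))

  IsG-unique : ∀ {a b b′} → IsG a b → IsG a b′ → b ≡ b′
  IsG-unique ((S , exact) , maximal) ((S′ , exact′) , maximal′) =
    ℕP.≤-antisym (maximal′ S _ exact) (maximal S′ _ exact′)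


module Polynomials where

  open import Defs
  open import Data.Nat using (ℕ; zero; suc; _^_)
  import Data.Nat.Properties as ℕP
  open import Data.Integer using (ℤ; +_; _+_; _*_)
  import Data.Integer.Properties as ℤP
  open import Data.Fin using (Fin)
  open import Data.Vec using (Vec; tabulate)
  import Data.Vec.Properties as VecP
  open import Relation.Binary.PropositionalEquality

  substitute : ∀ {n K} → Poly n → (Fin n → Poly K) → Poly K
  substitute (var i)   σ = σ i
  substitute (const c) σ = const c
  substitute (p ⊕ q)   σ = substitute p σ ⊕ substitute q σ
  substitute (p ⊗ q)   σ = substitute p σ ⊗ substitute q σ

  eval-substitute : ∀ {n K} (W : Poly n) (σ : Fin n → Poly K) z →
    eval (substitute W σ) z ≡ eval W (tabulate (λ i → eval (σ i) z))
  eval-substitute (var i)   σ z = sym (VecP.lookup∘tabulate (λ i → eval (σ i) z) i)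
  eval-substitute (const c) σ z = refl
  eval-substitute (p ⊕ q)   σ z = cong₂ _+_ (eval-substitute p σ z) (eval-substitute q σ z)
  eval-substitute (p ⊗ q)   σ z = cong₂ _*_ (eval-substitute p σ z) (eval-substitute q σ z)

  twoPow : ∀ {K} → ℕ → Poly K
  twoPow zero    = const (+ 1)
  twoPow (suc k) = twoPow k ⊗ const (+ 2)

  eval-twoPow : ∀ {K} k (z : Vec ℤ K) → eval (twoPow k) z ≡ + (2 ^ k)
  eval-twoPow zero    z = refl
  eval-twoPow (suc k) z = trans (cong (_* + 2) (eval-twoPow k z))
    (trans (sym (ℤP.pos-* (2 ^ k) 2)) (cong +_ (ℕP.*-comm (2 ^ k) 2)))


module StraightLinePrograms where

  open import Data.Nat as ℕ using (ℕ; zero; suc; s≤s; _<_)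
  import Data.Nat.Properties as ℕP
  open import Data.Integer using (ℤ; +_; _+_; _*_; _-_)
  import Data.Integer.Properties as ℤP
  open import Data.List using (List; []; _∷_; length; _++_; [_]; _∷ʳ_)
  import Data.List.Properties as ListP
  open import Data.Product using (_×_; _,_)
  open import Data.Sum using (inj₁; inj₂)
  open import Data.Unit using (⊤; tt)
  open import Relation.Binary.PropositionalEquality hiding ([_])
  open import Data.Integer.Tactic.RingSolver using (solve-∀)

  -- Registers are numbered by ℕ; reading past the end of the register file gives 0.
  reg : List ℤ → ℕ → ℤ
  reg []       _       = + 0
  reg (x ∷ xs) zero    = x
  reg (x ∷ xs) (suc i) = reg xs i

  reg-++ˡ : ∀ xs ys i → i < length xs → reg (xs ++ ys) i ≡ reg xs i
  reg-++ˡ (x ∷ xs) ys zero    _         = refl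
  reg-++ˡ (x ∷ xs) ys (suc i) (s≤s i<n) = reg-++ˡ xs ys i i<n

  reg-length : ∀ xs y ys → reg (xs ++ y ∷ ys) (length xs) ≡ y
  reg-length []       y ys = refl
  reg-length (x ∷ xs) y ys = reg-length xs y ys

  length-∷ʳ : ∀ {A : Set} (xs : List A) v → length (xs ∷ʳ v) ≡ suc (length xs)
  length-∷ʳ xs v = trans (ListP.length-++ xs) (ℕP.+-comm (length xs) 1)

  data Instr : Set where
    set1 set0        : Instr
    plus times minus : ℕ → ℕ → Instr

  Program : Set
  Program = List Instr

  evalInstr : (ℕ → ℤ) → Instr → ℤ
  evalInstr r set1        = + 1
  evalInstr r set0        = + 0
  evalInstr r (plus i j)  = r i + r j
  evalInstr r (times i j) = r i * r j
  evalInstr r (minus i j) = r j - r i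

  -- The instruction writing register t, read as an equation of E_n.
  SatInstr : (ℕ → ℤ) → ℕ → Instr → Set
  SatInstr r t set1        = r t ≡ + 1
  SatInstr r t set0        = r t + r t ≡ r t
  SatInstr r t (plus i j)  = r i + r j ≡ r t
  SatInstr r t (times i j) = r i * r j ≡ r t
  SatInstr r t (minus i j) = r t + r i ≡ r j

  SatProgram : (ℕ → ℤ) → ℕ → Program → Set
  SatProgram r t []       = ⊤
  SatProgram r t (o ∷ os) = SatInstr r t o × SatProgram r (suc t) os

  ReadsBelow : Instr → ℕ → Set
  ReadsBelow set1        t = ⊤
  ReadsBelow set0        t = ⊤
  ReadsBelow (plus i j)  t = i < t × j < t
  ReadsBelow (times i j) t = i < t × j < t
  ReadsBelow (minus i j) t = i < t × j < t

  WellScoped : ℕ → Program → Set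
  WellScoped t []       = ⊤
  WellScoped t (o ∷ os) = ReadsBelow o t × WellScoped (suc t) os

  WellScoped-++ : ∀ xs ys n → WellScoped n xs → WellScoped (n ℕ.+ length xs) ys → WellScoped n (xs ++ ys)
  WellScoped-++ []       ys n _          ws = subst (λ k → WellScoped k ys) (ℕP.+-identityʳ n) ws
  WellScoped-++ (x ∷ xs) ys n (rx , wxs) ws =
    rx , WellScoped-++ xs ys (suc n) wxs (subst (λ k → WellScoped k ys) (ℕP.+-suc n (length xs)) ws)

  execute : List ℤ → Program → List ℤ
  execute rs []       = rs
  execute rs (o ∷ os) = execute (rs ∷ʳ evalInstr (reg rs) o) os

  length-execute : ∀ rs os → length (execute rs os) ≡ length rs ℕ.+ length os
  length-execute rs []       = sym (ℕP.+-identityʳ _)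
  length-execute rs (o ∷ os) = trans (length-execute (rs ∷ʳ _) os)
    (trans (cong (ℕ._+ length os) (length-∷ʳ rs _)) (sym (ℕP.+-suc (length rs) (length os))))

  execute-++ : ∀ rs os₁ os₂ → execute rs (os₁ ++ os₂) ≡ execute (execute rs os₁) os₂
  execute-++ rs []        os₂ = refl
  execute-++ rs (o ∷ os₁) os₂ = execute-++ (rs ∷ʳ _) os₁ os₂

  reg-execute : ∀ rs os i → i < length rs → reg (execute rs os) i ≡ reg rs i
  reg-execute rs []       i i<n = refl
  reg-execute rs (o ∷ os) i i<n =
    trans (reg-execute (rs ∷ʳ _) os i (subst (i <_) (sym (length-∷ʳ rs _)) (ℕP.m<n⇒m<1+n i<n)))
          (reg-++ˡ rs _ i i<n)

  x≡[x+y]-y : ∀ x y → x ≡ (x + y) - y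
  x≡[x+y]-y = solve-∀

  x+x≡x⇒x≡0 : ∀ x → x + x ≡ x → x ≡ + 0
  x+x≡x⇒x≡0 x x+x≡x = trans (x≡[x+y]-y x x) (trans (cong (_- x) x+x≡x) (ℤP.+-inverseʳ x))

  SatInstr⇒≡evalInstr : ∀ r t o → SatInstr r t o → r t ≡ evalInstr r o
  SatInstr⇒≡evalInstr r t set1        sat = sat
  SatInstr⇒≡evalInstr r t set0        sat = x+x≡x⇒x≡0 (r t) sat
  SatInstr⇒≡evalInstr r t (plus i j)  sat = sym sat
  SatInstr⇒≡evalInstr r t (times i j) sat = sym sat
  SatInstr⇒≡evalInstr r t (minus i j) sat = trans (x≡[x+y]-y (r t) (r i)) (cong (_- r i) sat)

  ≡evalInstr⇒SatInstr : ∀ r t o → r t ≡ evalInstr r o → SatInstr r t o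
  ≡evalInstr⇒SatInstr r t set1        eq = eq
  ≡evalInstr⇒SatInstr r t set0        eq = subst (λ v → v + v ≡ v) (sym eq) refl
  ≡evalInstr⇒SatInstr r t (plus i j)  eq = sym eq
  ≡evalInstr⇒SatInstr r t (times i j) eq = sym eq
  ≡evalInstr⇒SatInstr r t (minus i j) eq = subst (λ v → v + r i ≡ r j) (sym eq) (cancel (r j) (r i))
    where
    cancel : ∀ x y → (x - y) + y ≡ x
    cancel = solve-∀

  evalInstr-cong : ∀ r r′ t o → ReadsBelow o t → (∀ i → i < t → r i ≡ r′ i) → evalInstr r o ≡ evalInstr r′ o
  evalInstr-cong r r′ t set1        _         _  = refl
  evalInstr-cong r r′ t set0        _         _  = refl
  evalInstr-cong r r′ t (plus i j)  (i< , j<) eq = cong₂ _+_ (eq i i<) (eq j j<)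
  evalInstr-cong r r′ t (times i j) (i< , j<) eq = cong₂ _*_ (eq i i<) (eq j j<)
  evalInstr-cong r r′ t (minus i j) (i< , j<) eq = cong₂ _-_ (eq j j<) (eq i i<)

  SatProgram⇒≡execute : ∀ os rs n r → length rs ≡ n → WellScoped n os → SatProgram r n os →
    (∀ i → i < n → r i ≡ reg rs i) → ∀ i → i < n ℕ.+ length os → r i ≡ reg (execute rs os) i
  SatProgram⇒≡execute [] rs n r _ _ _ agree i i<n+0 = agree i (subst (i <_) (ℕP.+-identityʳ n) i<n+0)
  SatProgram⇒≡execute (o ∷ os) rs n r refl (reads , ws) (sat , sats) agree i i< =
    SatProgram⇒≡execute os rs′ (suc n) r (length-∷ʳ rs _) ws sats agree′ i (subst (i <_) (ℕP.+-suc n (length os)) i<)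
    where
    rs′ = rs ∷ʳ evalInstr (reg rs) o
    agree′ : ∀ i → i < suc n → r i ≡ reg rs′ i
    agree′ i i<1+n with ℕP.m≤n⇒m<n∨m≡n (ℕ.s≤s⁻¹ i<1+n)
    ... | inj₁ i<n  = trans (agree i i<n) (sym (reg-++ˡ rs _ i i<n))
    ... | inj₂ refl = trans (SatInstr⇒≡evalInstr r (length rs) o sat)
                        (trans (evalInstr-cong r (reg rs) (length rs) o reads agree) (sym (reg-length rs _ [])))

  execute-satisfies : ∀ os rs n r → length rs ≡ n → WellScoped n os →
    (∀ i → i < n ℕ.+ length os → r i ≡ reg (execute rs os) i) → SatProgram r n os
  execute-satisfies []       rs n r _    _            _     = tt
  execute-satisfies (o ∷ os) rs n r refl (reads , ws) agree =
    ≡evalInstr⇒SatInstr r (length rs) o r[n]≡ ,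
    execute-satisfies os rs′ (suc n) r (length-∷ʳ rs _) ws (λ i i< → agree i (subst (i <_) (sym (ℕP.+-suc n (length os))) i<))
    where
    rs′ = rs ∷ʳ evalInstr (reg rs) o
    n<n+1+|os| : n < n ℕ.+ length (o ∷ os)
    n<n+1+|os| = subst (n <_) (sym (ℕP.+-suc n (length os))) (s≤s (ℕP.m≤m+n n _))
    agree-below : ∀ i → i < n → r i ≡ reg rs i
    agree-below i i<n = trans (agree i (ℕP.<-≤-trans i<n (ℕP.m≤m+n n _)))
      (trans (reg-execute rs′ os i (subst (i <_) (sym (length-∷ʳ rs _)) (ℕP.m<n⇒m<1+n i<n))) (reg-++ˡ rs _ i i<n))
    r[n]≡ : r n ≡ evalInstr r o
    r[n]≡ = trans (agree n n<n+1+|os|)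
      (trans (reg-execute rs′ os n (subst (n <_) (sym (length-∷ʳ rs _)) (ℕP.n<1+n n)))
        (trans (reg-length rs _ []) (evalInstr-cong (reg rs) r n o reads (λ i i<n → sym (agree-below i i<n)))))

  SatProgram-cong : ∀ os n r r′ → WellScoped n os → (∀ i → i < n ℕ.+ length os → r i ≡ r′ i) →
    SatProgram r n os → SatProgram r′ n os
  SatProgram-cong []       n r r′ _            _  _            = tt
  SatProgram-cong (o ∷ os) n r r′ (reads , ws) eq (sat , sats) =
    ≡evalInstr⇒SatInstr r′ n o (trans (sym (eq n n<n+1+|os|))
      (trans (SatInstr⇒≡evalInstr r n o sat) (evalInstr-cong r r′ n o reads (λ i i< → eq i (ℕP.<-≤-trans i< (ℕP.m≤m+n n _)))))) ,
    SatProgram-cong os (suc n) r r′ ws (λ i i< → eq i (subst (i <_) (sym (ℕP.+-suc n (length os))) i<)) sats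
    where
    n<n+1+|os| : n < n ℕ.+ length (o ∷ os)
    n<n+1+|os| = subst (n <_) (sym (ℕP.+-suc n (length os))) (s≤s (ℕP.m≤m+n n _))

  WellScoped-∷ʳ : ∀ {n} os o → WellScoped n os → ReadsBelow o (n ℕ.+ length os) → WellScoped n (os ∷ʳ o)
  WellScoped-∷ʳ {n} os o ws reads = WellScoped-++ os [ o ] n ws (reads , tt)

  reg-execute-∷ʳ : ∀ rs os o → reg (execute rs (os ∷ʳ o)) (length rs ℕ.+ length os) ≡ evalInstr (reg (execute rs os)) o
  reg-execute-∷ʳ rs os o = trans (cong (λ rs′ → reg rs′ (length rs ℕ.+ length os)) (execute-++ rs os [ o ]))
    (subst (λ k → reg (execute rs os ∷ʳ v) k ≡ v) (length-execute rs os) (reg-length (execute rs os) v []))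
    where v = evalInstr (reg (execute rs os)) o


module PolynomialCompiler where

  open import Defs
  open StraightLinePrograms
  open Polynomials using (twoPow)
  import Data.Nat.Tactic.RingSolver as ℕ-Solver
  open import Data.Nat as ℕ using (ℕ; zero; suc; _≤_; _<_; _+_; _*_)
  import Data.Nat.Properties as ℕP
  open import Data.Integer as ℤ using (ℤ; +_; -[1+_])
  import Data.Integer.Properties as ℤP
  open import Data.Fin using (toℕ)
  import Data.Fin.Properties as FinP
  open import Data.Vec using (Vec; lookup)
  open import Data.List using (List; []; length; _++_; _∷ʳ_)
  import Data.List.Properties as ListP
  open import Data.Product using (_,_)
  open import Relation.Binary.PropositionalEquality

  -- Registers 0, …, K - 1 hold the variables, register K holds 1 and register K + 1 holds 0.
  module _ (K : ℕ) where

    ONE ZERO : ℕ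
    ONE  = K
    ZERO = suc K

    record Compiled : Set where
      constructor compiled
      field
        code : Program
        out  : ℕ
    open Compiled public

    -- `n` is the first free register.
    extend : ∀ (C : Compiled) (n : ℕ) → (ℕ → Instr) → Compiled
    extend C n instr = compiled (code C ∷ʳ instr (out C)) (n + length (code C))

    compileℕ : ℕ → ℕ → Compiled
    compileℕ zero    n = compiled [] ZERO
    compileℕ (suc c) n = extend (compileℕ c n) n (λ r → plus r ONE)

    compileℤ : ℤ → ℕ → Compiled
    compileℤ (+ c)    n = compileℕ c n
    compileℤ -[1+ c ] n = extend (compileℕ (suc c) n) n (λ r → minus r ZERO)

    binary : (ℕ → ℕ → Instr) → Compiled → (ℕ → Compiled) → ℕ → Compiled
    binary instr P Q n = compiled ((code P ++ code Q′) ∷ʳ instr (out P) (out Q′)) (n + length (code P ++ code Q′))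
      where Q′ = Q (n + length (code P))

    compile : Poly K → ℕ → Compiled
    compile (var i)   n = compiled [] (toℕ i)
    compile (const c) n = compileℤ c n
    compile (p ⊕ q)   n = binary plus  (compile p n) (compile q) n
    compile (p ⊗ q)   n = binary times (compile p n) (compile q) n

    costℤ : ℤ → ℕ
    costℤ (+ c)    = c
    costℤ -[1+ c ] = suc (suc c)

    cost : Poly K → ℕ
    cost (var i)   = 0
    cost (const c) = costℤ c
    cost (p ⊕ q)   = cost p + cost q + 1
    cost (p ⊗ q)   = cost p + cost q + 1

    cost-twoPow : ∀ k → cost (twoPow k) ≡ suc (3 * k)
    cost-twoPow zero    = refl
    cost-twoPow (suc k) = trans (cong (λ c → c + 2 + 1) (cost-twoPow k)) (step k)
      where
      step : ∀ k → suc (3 * k) + 2 + 1 ≡ suc (3 * suc k)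
      step = ℕ-Solver.solve-∀

    length-extend : ∀ C n instr → length (code (extend C n instr)) ≡ suc (length (code C))
    length-extend C n instr = length-∷ʳ (code C) _

    length-compileℕ : ∀ c n → length (code (compileℕ c n)) ≡ c
    length-compileℕ zero    n = refl
    length-compileℕ (suc c) n = trans (length-extend (compileℕ c n) n (λ r → plus r ONE)) (cong suc (length-compileℕ c n))

    length-compileℤ : ∀ c n → length (code (compileℤ c n)) ≡ costℤ c
    length-compileℤ (+ c)    n = length-compileℕ c n
    length-compileℤ -[1+ c ] n = trans (length-extend (compileℕ (suc c) n) n (λ r → minus r ZERO)) (cong suc (length-compileℕ (suc c) n))

    length-binary : ∀ instr P Q n → length (code (binary instr P Q n)) ≡ length (code P) + length (code (Q (n + length (code P)))) + 1
    length-binary instr P Q n = trans (length-∷ʳ (code P ++ _) _) (trans (ℕP.+-comm 1 _) (cong (_+ 1) (ListP.length-++ (code P))))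

    length-compile : ∀ p n → length (code (compile p n)) ≡ cost p
    length-compile (var i)   n = refl
    length-compile (const c) n = length-compileℤ c n
    length-compile (p ⊕ q)   n = trans (length-binary plus (compile p n) (compile q) n)
                                       (cong₂ (λ a b → a + b + 1) (length-compile p n) (length-compile q _))
    length-compile (p ⊗ q)   n = trans (length-binary times (compile p n) (compile q) n)
                                       (cong₂ (λ a b → a + b + 1) (length-compile p n) (length-compile q _))

    record Initialised (rs : List ℤ) (n : ℕ) (z : Vec ℤ K) : Set where
      field
        length≡  : length rs ≡ n
        2+K≤n    : suc (suc K) ≤ n
        reg-ONE  : reg rs ONE ≡ + 1
        reg-ZERO : reg rs ZERO ≡ + 0
        reg-var  : ∀ i → reg rs (toℕ i) ≡ lookup z i
    open Initialised

    initialised-execute : ∀ {rs n z} os → Initialised rs n z → Initialised (execute rs os) (n + length os) z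
    initialised-execute {rs} {n} os init = record
      { length≡  = trans (length-execute rs os) (cong (_+ length os) (length≡ init))
      ; 2+K≤n    = ℕP.≤-trans (2+K≤n init) (ℕP.m≤m+n n _)
      ; reg-ONE  = trans (reg-execute rs os ONE (below-n K<2+K)) (reg-ONE init)
      ; reg-ZERO = trans (reg-execute rs os ZERO (below-n ℕP.≤-refl)) (reg-ZERO init)
      ; reg-var  = λ i → trans (reg-execute rs os (toℕ i) (below-n (ℕP.<-trans (FinP.toℕ<n i) K<2+K)))
                               (reg-var init i)
      }
      where
      K<2+K = ℕP.m<n⇒m<1+n (ℕP.n<1+n K)
      below-n : ∀ {i} → i < suc (suc K) → i < length rs
      below-n i<2+K = subst (_ <_) (sym (length≡ init)) (ℕP.<-≤-trans i<2+K (2+K≤n init))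

    record Computes (C : Compiled) (n : ℕ) (rs : List ℤ) (v : ℤ) : Set where
      field
        scoped : WellScoped n (code C)
        out<   : out C < n + length (code C)
        value  : reg (execute rs (code C)) (out C) ≡ v
    open Computes public

    computes-extend : ∀ {C n rs z} instr → Initialised rs n z → WellScoped n (code C) →
      ReadsBelow (instr (out C)) (n + length (code C)) →
      Computes (extend C n instr) n rs (evalInstr (reg (execute rs (code C))) (instr (out C)))
    computes-extend {C} {n} {rs} instr init ws reads = record
      { scoped = WellScoped-∷ʳ (code C) (instr (out C)) ws reads
      ; out<   = subst (n + length (code C) <_) (sym (trans (cong (λ k → n + k) (length-∷ʳ (code C) _)) (ℕP.+-suc n _))) (ℕP.n<1+n _)
      ; value  = subst (λ k → reg (execute rs (code C ∷ʳ instr (out C))) (k + length (code C)) ≡ _)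
                       (length≡ init) (reg-execute-∷ʳ rs (code C) (instr (out C)))
      }

    ONE<n+ : ∀ {rs n z} → Initialised rs n z → ∀ k → ONE < n + k
    ONE<n+ init k = ℕP.<-≤-trans (ℕP.n<1+n K) (ℕP.≤-trans (ℕP.n≤1+n (suc K)) (ℕP.≤-trans (2+K≤n init) (ℕP.m≤m+n _ k)))

    ZERO<n+ : ∀ {rs n z} → Initialised rs n z → ∀ k → ZERO < n + k
    ZERO<n+ init k = ℕP.≤-trans (2+K≤n init) (ℕP.m≤m+n _ k)

    computesℕ : ∀ c {n rs z} → Initialised rs n z → Computes (compileℕ c n) n rs (+ c)
    computesℕ zero    init = record { scoped = _ ; out< = ZERO<n+ init 0 ; value = reg-ZERO init }
    computesℕ (suc c) {n} {rs} init =
      subst (Computes _ n rs) c+1≡ (computes-extend (λ r → plus r ONE) init (scoped IH) (out< IH , ONE<n+ init _))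
      where
      C = compileℕ c n
      IH = computesℕ c init
      c+1≡ : reg (execute rs (code C)) (out C) ℤ.+ reg (execute rs (code C)) ONE ≡ + suc c
      c+1≡ = trans (cong₂ ℤ._+_ (value IH) (reg-ONE (initialised-execute (code C) init)))
                   (trans (sym (ℤP.pos-+ c 1)) (cong +_ (ℕP.+-comm c 1)))

    computesℤ : ∀ c {n rs z} → Initialised rs n z → Computes (compileℤ c n) n rs c
    computesℤ (+ c)    init = computesℕ c init
    computesℤ -[1+ c ] {n} {rs} init =
      subst (Computes _ n rs) 0-[1+c]≡ (computes-extend (λ r → minus r ZERO) init (scoped IH) (out< IH , ZERO<n+ init _))
      where
      C = compileℕ (suc c) n
      IH = computesℕ (suc c) init
      0-[1+c]≡ : reg (execute rs (code C)) ZERO ℤ.- reg (execute rs (code C)) (out C) ≡ -[1+ c ]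
      0-[1+c]≡ = cong₂ ℤ._-_ (reg-ZERO (initialised-execute (code C) init)) (value IH)

    computes-binary : ∀ (instr : ℕ → ℕ → Instr) (f : ℤ → ℤ → ℤ) → (∀ r i j → evalInstr r (instr i j) ≡ f (r i) (r j)) →
      (∀ i j t → i < t → j < t → ReadsBelow (instr i j) t) →
      ∀ {P Q n rs z u v} → Initialised rs n z → Computes P n rs u →
      Computes (Q (n + length (code P))) (n + length (code P)) (execute rs (code P)) v →
      Computes (binary instr P Q n) n rs (f u v)
    computes-binary instr f eval-instr reads-instr {P} {Q} {n} {rs} {z} {u} {v} init cP cQ =
      subst (Computes _ n rs) value≡
        (computes-extend {compiled PQ (out P)} (λ _ → instr (out P) (out Q′)) init
          (WellScoped-++ (code P) (code Q′) n (scoped cP) (scoped cQ))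
          (reads-instr (out P) (out Q′) _ (ℕP.<-≤-trans (out< cP) n₁≤) (subst (out Q′ <_) n₁+Q≡ (out< cQ))))
      where
      Q′ = Q (n + length (code P))
      PQ = code P ++ code Q′
      n₁≤ : n + length (code P) ≤ n + length PQ
      n₁≤ = subst (λ k → n + length (code P) ≤ n + k) (sym (ListP.length-++ (code P))) (ℕP.+-monoʳ-≤ n (ℕP.m≤m+n _ _))
      n₁+Q≡ : n + length (code P) + length (code Q′) ≡ n + length PQ
      n₁+Q≡ = trans (ℕP.+-assoc n _ _) (cong (λ k → n + k) (sym (ListP.length-++ (code P))))
      rsP = execute rs (code P)
      reg-PQ≡ : ∀ i → reg (execute rs PQ) i ≡ reg (execute rsP (code Q′)) i
      reg-PQ≡ i = cong (λ rs′ → reg rs′ i) (execute-++ rs (code P) (code Q′))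
      out<length : out P < length rsP
      out<length = subst (out P <_) (sym (trans (length-execute rs (code P)) (cong (_+ length (code P)) (length≡ init)))) (out< cP)
      value≡ : evalInstr (reg (execute rs PQ)) (instr (out P) (out Q′)) ≡ f u v
      value≡ = trans (eval-instr (reg (execute rs PQ)) (out P) (out Q′))
        (cong₂ f (trans (reg-PQ≡ (out P)) (trans (reg-execute rsP (code Q′) (out P) out<length) (value cP)))
                 (trans (reg-PQ≡ (out Q′)) (value cQ)))

    compile-computes : ∀ p {n rs z} → Initialised rs n z → Computes (compile p n) n rs (eval p z)
    compile-computes (var i)   init = record
      { scoped = _
      ; out<   = ℕP.<-≤-trans (FinP.toℕ<n i) (ℕP.≤-trans (ℕP.n≤1+n K) (ℕP.≤-trans (ℕP.n≤1+n (suc K))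
                   (ℕP.≤-trans (2+K≤n init) (ℕP.m≤m+n _ 0))))
      ; value  = reg-var init i
      }
    compile-computes (const c) init = computesℤ c init
    compile-computes (p ⊕ q) {n} init = computes-binary plus ℤ._+_ (λ _ _ _ → refl) (λ _ _ _ i< j< → i< , j<) {Q = compile q} init
      (compile-computes p init) (compile-computes q (initialised-execute (code (compile p n)) init))
    compile-computes (p ⊗ q) {n} init = computes-binary times ℤ._*_ (λ _ _ _ → refl) (λ _ _ _ i< j< → i< , j<) {Q = compile q} init
      (compile-computes p init) (compile-computes q (initialised-execute (code (compile p n)) init))


module PolynomialSystem where

  open import Defs
  open Preliminaries
  open StraightLinePrograms
  open PolynomialCompiler
  open import Data.Nat as ℕ using (ℕ; zero; suc; z≤n; s≤s; _≤_; _<_; _∸_; _+_)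
  import Data.Nat.Properties as ℕP
  open import Data.Integer as ℤ using (ℤ; +_)
  open import Data.Fin as Fin using (Fin; toℕ; fromℕ<)
  import Data.Fin.Properties as FinP
  open import Data.Vec as Vec using (Vec; lookup; tabulate; toList)
  import Data.Vec.Properties as VecP
  open import Data.List as List using (List; []; _∷_; length; _++_; applyUpTo; replicate)
  import Data.List.Membership.Propositional.Properties as ∈P
  open import Data.List.Relation.Unary.All as All using (All; []; _∷_)
  open import Data.List.Relation.Unary.Any using (here; there)
  import Data.List.Relation.Unary.All.Properties as AllP
  open import Data.Product using (_×_; _,_)
  open import Data.Empty using (⊥-elim)
  open import Relation.Nullary using (yes; no)
  open import Relation.Binary.PropositionalEquality

  reg-toList : ∀ {K} (z : Vec ℤ K) (i : Fin K) → reg (toList z) (toℕ i) ≡ lookup z i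
  reg-toList (x Vec.∷ z) Fin.zero    = refl
  reg-toList (x Vec.∷ z) (Fin.suc i) = reg-toList z i

  reg-replicate : ∀ (rs : List ℤ) k v i → length rs ≤ i → i < length rs + k → reg (rs ++ replicate k v) i ≡ v
  reg-replicate []       (suc k) v zero    _         _         = refl
  reg-replicate []       (suc k) v (suc i) _         (s≤s i<) = reg-replicate [] k v i z≤n i<
  reg-replicate (x ∷ rs) k       v (suc i) (s≤s ≤i) (s≤s i<) = reg-replicate rs k v i ≤i i<

  record Encoding {K} (A : ℕ) (P : Poly K) : Set where
    field
      system         : System A
      embed          : Vec ℤ K → Vec ℤ A
      restrict       : Vec ℤ A → Vec ℤ K
      embed-solution : ∀ z → eval P z ≡ + 0 → Solution system (embed z)
      solution-embed : ∀ v → Solution system v → eval P (restrict v) ≡ + 0 × v ≡ embed (restrict v)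
      restrict-embed : ∀ z → restrict (embed z) ≡ z

  -- Register t of the program becomes variable t of the system; the registers are followed by
  -- padding variables fixed to 1.
  module Encode {K A′ : ℕ} (P : Poly K) (M≤A : K + 2 + cost K P ≤ suc A′) where

    A = suc A′
    n₀ = suc (suc K)
    C = compile K P n₀
    D : Program
    D = set1 ∷ set0 ∷ code C
    M = K + length D

    M≡ : M ≡ K + 2 + cost K P
    M≡ = trans (cong (λ c → K + suc (suc c)) (length-compile K P n₀)) (sym (ℕP.+-assoc K 2 (cost K P)))

    M≤A′ : M ≤ A
    M≤A′ = subst (_≤ A) (sym M≡) M≤A

    -- Out-of-range registers are sent to variable 0; they never occur.
    clamp : ℕ → Fin A
    clamp i with i ℕ.≤? A′
    ... | yes i≤A′ = fromℕ< (s≤s i≤A′)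
    ... | no  _    = Fin.zero

    toℕ-clamp : ∀ i → i < A → toℕ (clamp i) ≡ i
    toℕ-clamp i i<A with i ℕ.≤? A′
    ... | yes i≤A′ = FinP.toℕ-fromℕ< (s≤s i≤A′)
    ... | no  i≰A′ = ⊥-elim (i≰A′ (ℕ.s≤s⁻¹ i<A))

    clamp-toℕ : ∀ f → clamp (toℕ f) ≡ f
    clamp-toℕ f = FinP.toℕ-injective (toℕ-clamp (toℕ f) (FinP.toℕ<n f))

    val : Vec ℤ A → ℕ → ℤ
    val v i = lookup v (clamp i)

    eqnOf : ℕ → Instr → Eqn A
    eqnOf t set1        = one (clamp t)
    eqnOf t set0        = add (clamp t) (clamp t) (clamp t)
    eqnOf t (plus i j)  = add (clamp i) (clamp j) (clamp t)
    eqnOf t (times i j) = mul (clamp i) (clamp j) (clamp t)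
    eqnOf t (minus i j) = add (clamp t) (clamp i) (clamp j)

    eqnsOf : ℕ → Program → System A
    eqnsOf t []       = []
    eqnsOf t (o ∷ os) = eqnOf t o ∷ eqnsOf (suc t) os

    satInstr⇒sat : ∀ v t o → SatInstr (val v) t o → Sat v (eqnOf t o)
    satInstr⇒sat v t set1        sat = sat
    satInstr⇒sat v t set0        sat = sat
    satInstr⇒sat v t (plus i j)  sat = sat
    satInstr⇒sat v t (times i j) sat = sat
    satInstr⇒sat v t (minus i j) sat = sat

    sat⇒satInstr : ∀ v t o → Sat v (eqnOf t o) → SatInstr (val v) t o
    sat⇒satInstr v t set1        sat = sat
    sat⇒satInstr v t set0        sat = sat
    sat⇒satInstr v t (plus i j)  sat = sat
    sat⇒satInstr v t (times i j) sat = sat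
    sat⇒satInstr v t (minus i j) sat = sat

    satProgram⇒solution : ∀ v t os → SatProgram (val v) t os → Solution (eqnsOf t os) v
    satProgram⇒solution v t []       _            = []
    satProgram⇒solution v t (o ∷ os) (sat , sats) = satInstr⇒sat v t o sat ∷ satProgram⇒solution v (suc t) os sats

    solution⇒satProgram : ∀ v t os → Solution (eqnsOf t os) v → SatProgram (val v) t os
    solution⇒satProgram v t []       _            = _
    solution⇒satProgram v t (o ∷ os) (sat ∷ sats) = sat⇒satInstr v t o sat , solution⇒satProgram v (suc t) os sats

    zeroEqn : Eqn A
    zeroEqn = add (clamp (out C)) (clamp (out C)) (clamp (out C))

    padding : System A
    padding = applyUpTo (λ j → one (clamp (M + j))) (A ∸ M)

    system : System A
    system = eqnsOf K D ++ zeroEqn ∷ padding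

    registers : Vec ℤ K → List ℤ
    registers z = execute (toList z) D ++ replicate (A ∸ M) (+ 1)

    embed : Vec ℤ K → Vec ℤ A
    embed z = tabulate (λ f → reg (registers z) (toℕ f))

    restrict : Vec ℤ A → Vec ℤ K
    restrict v = tabulate (λ (j : Fin K) → val v (toℕ j))

    initialised : ∀ z → Initialised K (execute (toList z) (set1 ∷ set0 ∷ [])) n₀ z
    initialised z = record
      { length≡  = trans (length-∷ʳ (toList z List.∷ʳ + 1) (+ 0)) (cong suc |z∷ʳ1|≡)
      ; 2+K≤n    = ℕP.≤-refl
      ; reg-ONE  = trans (reg-++ˡ (toList z List.∷ʳ + 1) _ K K<) (subst (λ k → reg (toList z List.∷ʳ + 1) k ≡ + 1)
                     (VecP.length-toList z) (reg-length (toList z) (+ 1) []))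
      ; reg-ZERO = subst (λ k → reg ((toList z List.∷ʳ + 1) List.∷ʳ + 0) k ≡ + 0)
                     |z∷ʳ1|≡ (reg-length (toList z List.∷ʳ + 1) (+ 0) [])
      ; reg-var  = λ i → trans (reg-++ˡ (toList z List.∷ʳ + 1) _ (toℕ i) (ℕP.<-trans (FinP.toℕ<n i) K<))
                         (trans (reg-++ˡ (toList z) _ (toℕ i) (i<|z| i)) (reg-toList z i))
      }
      where
      K< : K < length (toList z List.∷ʳ + 1)
      |z∷ʳ1|≡ : length (toList z List.∷ʳ + 1) ≡ suc K
      |z∷ʳ1|≡ = trans (length-∷ʳ (toList z) (+ 1)) (cong suc (VecP.length-toList z))
      K< = subst (K <_) (sym |z∷ʳ1|≡) (ℕP.n<1+n K)
      i<|z| : ∀ (i : Fin K) → toℕ i < length (toList z)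
      i<|z| i = subst (toℕ i <_) (sym (VecP.length-toList z)) (FinP.toℕ<n i)

    computes : ∀ z → Computes K C n₀ (execute (toList z) (set1 ∷ set0 ∷ [])) (eval P z)
    computes z = compile-computes K P (initialised z)

    scoped-D : ∀ z → WellScoped K D
    scoped-D z = _ , _ , scoped (computes z)

    length-execute-D : ∀ z → length (execute (toList z) D) ≡ M
    length-execute-D z = trans (length-execute (toList z) D) (cong (_+ length D) (VecP.length-toList z))

    out<M : ∀ z → out C < M
    out<M z = subst (out C <_) (sym (trans (ℕP.+-suc K _) (ℕP.+-suc (suc K) _))) (out< (computes z))

    val-embed : ∀ z i → i < A → val (embed z) i ≡ reg (registers z) i
    val-embed z i i<A = trans (VecP.lookup∘tabulate (λ f → reg (registers z) (toℕ f)) (clamp i)) (cong (reg (registers z)) (toℕ-clamp i i<A))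

    registers-program : ∀ z i → i < M → reg (registers z) i ≡ reg (execute (toList z) D) i
    registers-program z i i<M = reg-++ˡ (execute (toList z) D) _ i (subst (i <_) (sym (length-execute-D z)) i<M)

    registers-padding : ∀ z i → M ≤ i → i < A → reg (registers z) i ≡ + 1
    registers-padding z i M≤i i<A = reg-replicate (execute (toList z) D) (A ∸ M) (+ 1) i
      (subst (_≤ i) (sym (length-execute-D z)) M≤i)
      (subst (i <_) (sym (trans (cong (_+ (A ∸ M)) (length-execute-D z)) (ℕP.m+[n∸m]≡n M≤A′))) i<A)

    zeroEqn-sat : ∀ v → val v (out C) ≡ + 0 → Sat v zeroEqn
    zeroEqn-sat v eq = subst (λ x → x ℤ.+ x ≡ x) (sym eq) refl

    embed-solution : ∀ z → eval P z ≡ + 0 → Solution system (embed z)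
    embed-solution z P≡0 = AllP.++⁺ program-sat (zeroEqn-sat (embed z) out≡0 ∷ padding-sat)
      where
      below-A : ∀ {i} → i < M → i < A
      below-A i<M = ℕP.<-≤-trans i<M M≤A′
      program-sat : Solution (eqnsOf K D) (embed z)
      program-sat = satProgram⇒solution (embed z) K D
        (SatProgram-cong D K (reg (registers z)) (val (embed z)) (scoped-D z)
          (λ i i<M → sym (val-embed z i (below-A i<M)))
          (execute-satisfies D (toList z) K (reg (registers z)) (VecP.length-toList z) (scoped-D z) (registers-program z)))
      out≡0 : val (embed z) (out C) ≡ + 0
      out≡0 = trans (val-embed z (out C) (below-A (out<M z)))
                (trans (registers-program z (out C) (out<M z)) (trans (value (computes z)) P≡0))
      padding-sat : All (Sat (embed z)) padding
      padding-sat = AllP.applyUpTo⁺₁ _ (A ∸ M) λ {j} j<A∸M →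
        trans (val-embed z (M + j) (M+j<A j<A∸M)) (registers-padding z (M + j) (ℕP.m≤m+n M j) (M+j<A j<A∸M))
        where
        M+j<A : ∀ {j} → j < A ∸ M → M + j < A
        M+j<A {j} j< = subst (M + j <_) (ℕP.m+[n∸m]≡n M≤A′) (ℕP.+-monoʳ-< M j<)

    restrict-embed : ∀ z → restrict (embed z) ≡ z
    restrict-embed z = lookup-ext λ j → begin
      lookup (restrict (embed z)) j            ≡⟨ VecP.lookup∘tabulate (λ (j : Fin K) → val (embed z) (toℕ j)) j ⟩
      val (embed z) (toℕ j)                    ≡⟨ val-embed z (toℕ j) (ℕP.<-≤-trans (j<M j) M≤A′) ⟩
      reg (registers z) (toℕ j)                ≡⟨ registers-program z (toℕ j) (j<M j) ⟩
      reg (execute (toList z) D) (toℕ j)       ≡⟨ reg-execute (toList z) D (toℕ j) (subst (toℕ j <_) (sym (VecP.length-toList z)) (FinP.toℕ<n j)) ⟩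
      reg (toList z) (toℕ j)                   ≡⟨ reg-toList z j ⟩
      lookup z j                               ∎
      where
      open ≡-Reasoning
      j<M : ∀ (j : Fin K) → toℕ j < M
      j<M j = ℕP.<-≤-trans (FinP.toℕ<n j) (ℕP.m≤m+n K _)

    solution-embed : ∀ v → Solution system v → eval P (restrict v) ≡ + 0 × v ≡ embed (restrict v)
    solution-embed v sol = P≡0 , v≡embed
      where
      z = restrict v
      program-sol = AllP.++⁻ˡ (eqnsOf K D) sol
      rest : All (Sat v) (zeroEqn ∷ padding)
      rest = AllP.++⁻ʳ (eqnsOf K D) sol
      agree-vars : ∀ i → i < K → val v i ≡ reg (toList z) i
      agree-vars i i<K = begin
        val v i                            ≡⟨ cong (val v) (sym (FinP.toℕ-fromℕ< i<K)) ⟩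
        val v (toℕ (fromℕ< i<K))           ≡⟨ sym (VecP.lookup∘tabulate (λ (j : Fin K) → val v (toℕ j)) (fromℕ< i<K)) ⟩
        lookup z (fromℕ< i<K)              ≡⟨ sym (reg-toList z (fromℕ< i<K)) ⟩
        reg (toList z) (toℕ (fromℕ< i<K))  ≡⟨ cong (reg (toList z)) (FinP.toℕ-fromℕ< i<K) ⟩
        reg (toList z) i                   ∎
        where open ≡-Reasoning
      agree-program : ∀ i → i < M → val v i ≡ reg (execute (toList z) D) i
      agree-program = SatProgram⇒≡execute D (toList z) K (val v) (VecP.length-toList z) (scoped-D z)
                        (solution⇒satProgram v K D program-sol) agree-vars
      agree-padding : ∀ i → M ≤ i → i < A → val v i ≡ + 1
      agree-padding i M≤i i<A = subst (λ k → val v k ≡ + 1) (ℕP.m+[n∸m]≡n M≤i)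
        (All.lookup rest (there (∈P.∈-applyUpTo⁺ (λ j → one (clamp (M + j))) (ℕP.∸-monoˡ-< i<A M≤i))))
      v≡embed : v ≡ embed z
      v≡embed = lookup-ext λ f → begin
        lookup v f                   ≡⟨ cong (lookup v) (sym (clamp-toℕ f)) ⟩
        val v (toℕ f)                ≡⟨ agree (toℕ f) (FinP.toℕ<n f) ⟩
        reg (registers z) (toℕ f)    ≡⟨ sym (VecP.lookup∘tabulate (λ f → reg (registers z) (toℕ f)) f) ⟩
        lookup (embed z) f           ∎
        where
        open ≡-Reasoning
        agree : ∀ i → i < A → val v i ≡ reg (registers z) i
        agree i i<A with i ℕ.<? M
        ... | yes i<M = trans (agree-program i i<M) (sym (registers-program z i i<M))
        ... | no  i≮M = trans (agree-padding i (ℕP.≮⇒≥ i≮M) i<A) (sym (registers-padding z i (ℕP.≮⇒≥ i≮M) i<A))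
      P≡0 : eval P z ≡ + 0
      P≡0 = trans (sym (value (computes z))) (trans (sym (agree-program (out C) (out<M z)))
                   (x+x≡x⇒x≡0 (val v (out C)) (All.lookup rest (here refl))))

  encode : ∀ {K A} (P : Poly K) → K + 2 + cost K P ≤ A → Encoding A P
  encode {K} {zero} P M≤0 with ℕP.≤-trans (ℕP.m≤n+m 2 K) (ℕP.≤-trans (ℕP.m≤m+n (K + 2) (cost K P)) M≤0)
  ... | ()
  encode {A = suc A′} P M≤A = record { Encode P M≤A }


module BoundedVectors where

  open import Data.Nat using (ℕ; zero; suc; s≤s; _≤_)
  open import Data.Integer using (ℤ; +_; -[1+_]; -_; ∣_∣)
  open import Data.Fin using (Fin)
  open import Data.Vec using (Vec; []; _∷_; lookup)
  open import Data.List as List using (List; upTo; cartesianProductWith)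
  open import Data.List.Membership.Propositional using (_∈_)
  import Data.List.Membership.Propositional.Properties as ∈P
  open import Data.List.Relation.Unary.Any using (here)
  open import Relation.Binary.PropositionalEquality using (refl)

  range : ℕ → List ℤ
  range B = List.map +_ (upTo (suc B)) List.++ List.map (λ n → - + n) (upTo (suc B))

  ∈-range : ∀ B x → ∣ x ∣ ≤ B → x ∈ range B
  ∈-range B (+ n)    n≤B   = ∈P.∈-++⁺ˡ (∈P.∈-map⁺ +_ (∈P.∈-upTo⁺ (s≤s n≤B)))
  ∈-range B -[1+ n ] 1+n≤B = ∈P.∈-++⁺ʳ (List.map +_ (upTo (suc B))) (∈P.∈-map⁺ (λ n → - + n) (∈P.∈-upTo⁺ (s≤s 1+n≤B)))

  box : ∀ n → List ℤ → List (Vec ℤ n)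
  box zero    R = [] List.∷ List.[]
  box (suc n) R = cartesianProductWith _∷_ R (box n R)

  ∈-box : ∀ n R (v : Vec ℤ n) → (∀ i → lookup v i ∈ R) → v ∈ box n R
  ∈-box zero    R []      _      = here refl
  ∈-box (suc n) R (x ∷ v) all∈R = ∈P.∈-cartesianProductWith⁺ _∷_ (all∈R Fin.zero) (∈-box n R v (λ i → all∈R (Fin.suc i)))

  bounded-∈-box : ∀ {n} B (v : Vec ℤ n) → (∀ i → ∣ lookup v i ∣ ≤ B) → v ∈ box n (range B)
  bounded-∈-box {n} B v bounded = ∈-box n (range B) v (λ i → ∈-range B (lookup v i) (bounded i))


module Reduction where

  open import Defs
  open Preliminaries
  open FourSquares using (x²+y²≡0⇒; sumSqVec; normSq; sumSqVec≡normSq; ∣entry∣≤normSq)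
  open Polynomials
  open LagrangeFourSquare using (fourSquares; sumSqVec-fourSquares; normSq-fourSquares)
  open SolutionCounting
  open GreatestSolutionCount using (IsG-unique)
  open PolynomialCompiler using (cost; cost-twoPow)
  open PolynomialSystem using (Encoding; encode)
  open BoundedVectors
  open import Data.Nat as ℕ using (ℕ; zero; suc; _≤_; _∸_; _^_)
  import Data.Nat.Properties as ℕP
  open import Data.Integer as ℤ using (ℤ; +_; -[1+_]; _+_; _*_; -_; ∣_∣)
  import Data.Integer.Properties as ℤP
  open import Data.Fin as Fin using (Fin; combine; remQuot)
  import Data.Fin.Properties as FinP
  open import Data.Vec as Vec using (Vec; _∷_; lookup; tabulate; concat)
  import Data.Vec.Properties as VecP
  open import Data.List as List using (List; applyUpTo)
  import Data.List.Properties as ListP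
  open import Data.Nat.ListAction using (sum)
  open import Data.List.Membership.Propositional using (_∈_)
  import Data.List.Membership.Propositional.Properties as ∈P
  open import Data.List.Relation.Unary.All using (All)
  import Data.List.Relation.Unary.All.Properties as AllP
  open import Data.List.Relation.Unary.Unique.Propositional using (Unique)
  import Data.List.Relation.Unary.Unique.Propositional.Properties as UniqueP
  open import Data.Product using (Σ; _×_; _,_; proj₁; proj₂; uncurry)
  open import Data.Empty using (⊥)
  open import Relation.Binary.PropositionalEquality
  open import Function using (_∘_)
  open import Function.Bundles using (_⇔_; Equivalence)
  open import Data.Integer.Tactic.RingSolver using (solve-∀)
  import Data.Nat.Tactic.RingSolver as ℕ-Solver

  x-y≡0⇒x≡y : ∀ x y → x + -[1+ 0 ] * y ≡ + 0 → x ≡ y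
  x-y≡0⇒x≡y x y eq = trans (shift x y) (trans (cong (_+ y) eq) (ℤP.+-identityˡ y))
    where
    shift : ∀ x y → x ≡ (x + -[1+ 0 ] * y) + y
    shift = solve-∀

  x-x≡0 : ∀ x → x + -[1+ 0 ] * x ≡ + 0
  x-x≡0 = solve-∀

  -- Variable 0 carries the first argument a of W. The variables are otherwise grouped into 2 + m blocks
  -- of four; the squares of a block sum to one natural argument, except that blocks 0 and 1 together give b,
  -- which is what lets b be split in b + 1 ways.
  module Layout (m : ℕ) where

    K : ℕ
    K = suc ((2 ℕ.+ m) ℕ.* 4)

    blockVar : Fin (2 ℕ.+ m) → Fin 4 → Fin K
    blockVar j r = Fin.suc (combine j r)

    Fin-K-cases : (P : Fin K → Set) → P Fin.zero → (∀ j r → P (blockVar j r)) → ∀ i → P i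
    Fin-K-cases P p₀ p-block Fin.zero    = p₀
    Fin-K-cases P p₀ p-block (Fin.suc i) =
      subst (P ∘ Fin.suc) (FinP.combine-remQuot {2 ℕ.+ m} 4 i) (uncurry p-block (remQuot {2 ℕ.+ m} 4 i))

    block : Vec ℤ K → Fin (2 ℕ.+ m) → Vec ℤ 4
    block z j = tabulate (λ r → lookup z (blockVar j r))

    sumSqPoly : Fin (2 ℕ.+ m) → Poly K
    sumSqPoly j = ((sq Fin.zero ⊕ sq (Fin.suc Fin.zero)) ⊕ sq (Fin.suc (Fin.suc Fin.zero))) ⊕ sq (Fin.suc (Fin.suc (Fin.suc Fin.zero)))
      where
      sq : Fin 4 → Poly K
      sq r = var (blockVar j r) ⊗ var (blockVar j r)

    eval-sumSqPoly : ∀ j z → eval (sumSqPoly j) z ≡ + normSq (block z j)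
    eval-sumSqPoly j z = sumSqVec≡normSq (block z j)

    σ : Fin (2 ℕ.+ m) → Poly K
    σ Fin.zero              = var Fin.zero
    σ (Fin.suc Fin.zero)    = sumSqPoly Fin.zero ⊕ sumSqPoly (Fin.suc Fin.zero)
    σ (Fin.suc (Fin.suc j)) = sumSqPoly (Fin.suc (Fin.suc j))

    second : Vec ℤ K → ℕ
    second z = normSq (block z Fin.zero) ℕ.+ normSq (block z (Fin.suc Fin.zero))

    rest : Vec ℤ K → Vec ℕ m
    rest z = tabulate (λ j → normSq (block z (Fin.suc (Fin.suc j))))

    eval-σ : ∀ z a → lookup z Fin.zero ≡ + a → tabulate (λ i → eval (σ i) z) ≡ Vec.map +_ (a ∷ second z ∷ rest z)
    eval-σ z a z₀≡a = lookup-ext λ i → trans (VecP.lookup∘tabulate (λ i → eval (σ i) z) i) (eval-σ-at i)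
      where
      eval-σ-at : ∀ i → eval (σ i) z ≡ lookup (Vec.map +_ (a ∷ second z ∷ rest z)) i
      eval-σ-at Fin.zero              = z₀≡a
      eval-σ-at (Fin.suc Fin.zero)    =
        trans (cong₂ _+_ (eval-sumSqPoly Fin.zero z) (eval-sumSqPoly (Fin.suc Fin.zero) z))
              (sym (ℤP.pos-+ (normSq (block z Fin.zero)) (normSq (block z (Fin.suc Fin.zero)))))
      eval-σ-at (Fin.suc (Fin.suc j)) = trans (eval-sumSqPoly (Fin.suc (Fin.suc j)) z)
        (trans (cong +_ (sym (VecP.lookup∘tabulate (λ j → normSq (block z (Fin.suc (Fin.suc j)))) j)))
               (sym (VecP.lookup-map j +_ (rest z))))

    assemble : ℕ → Vec (Vec ℤ 4) (2 ℕ.+ m) → Vec ℤ K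
    assemble a blocks = + a ∷ concat blocks

    block-assemble : ∀ a blocks j → block (assemble a blocks) j ≡ lookup blocks j
    block-assemble a blocks j = lookup-ext λ r →
      trans (VecP.lookup∘tabulate (λ r → lookup (assemble a blocks) (blockVar j r)) r) (lookup-concat blocks j r)

  module Refutation (m : ℕ) (W : Poly (2 ℕ.+ m))
    (represents : ∀ a b → (1 ≤ a × IsG a b) ⇔ (Σ (Vec ℕ m) λ xs → evalℕ W (a ∷ b ∷ xs) ≡ + 0))
    (finite-fold : ∀ a b → Σ (List (Vec ℕ m)) λ L → ∀ xs → evalℕ W (a ∷ b ∷ xs) ≡ + 0 → xs ∈ L) where

    open Layout m

    W∘σ : Poly K
    W∘σ = substitute W σ

    eval-W∘σ : ∀ z a → lookup z Fin.zero ≡ + a → eval W∘σ z ≡ evalℕ W (a ∷ second z ∷ rest z)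
    eval-W∘σ z a z₀≡a = trans (eval-substitute W σ z) (cong (eval W) (eval-σ z a z₀≡a))

    gap : ℕ → Poly K
    gap k = var Fin.zero ⊕ (const -[1+ 0 ] ⊗ twoPow k)

    -- W∘σ² + gap² vanishes iff both do.
    P : ℕ → Poly K
    P k = (W∘σ ⊗ W∘σ) ⊕ (gap k ⊗ gap k)

    P≡0⇒ : ∀ k z → eval (P k) z ≡ + 0 → lookup z Fin.zero ≡ + 2 ^ k × evalℕ W (2 ^ k ∷ second z ∷ rest z) ≡ + 0
    P≡0⇒ k z eq = z₀≡2^k , trans (sym (eval-W∘σ z (2 ^ k) z₀≡2^k)) W∘σ≡0
      where
      both≡0 = x²+y²≡0⇒ (eval W∘σ z) (eval (gap k) z) eq
      W∘σ≡0 = proj₁ both≡0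
      z₀≡2^k = trans (x-y≡0⇒x≡y (lookup z Fin.zero) (eval (twoPow k) z) (proj₂ both≡0)) (eval-twoPow k z)

    ⇒P≡0 : ∀ k z → lookup z Fin.zero ≡ + 2 ^ k → evalℕ W (2 ^ k ∷ second z ∷ rest z) ≡ + 0 → eval (P k) z ≡ + 0
    ⇒P≡0 k z z₀≡2^k W≡0 = cong₂ (λ x y → x * x + y * y) (trans (eval-W∘σ z (2 ^ k) z₀≡2^k) W≡0) gap≡0
      where
      gap≡0 : eval (gap k) z ≡ + 0
      gap≡0 = trans (cong₂ (λ x y → x + -[1+ 0 ] * y) z₀≡2^k (eval-twoPow k z)) (x-x≡0 (+ 2 ^ k))

    size-P : ∀ k → K ℕ.+ 2 ℕ.+ cost K (P k) ≡ (K ℕ.+ 15 ℕ.+ 2 ℕ.* cost K W∘σ) ℕ.+ 6 ℕ.* k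
    size-P k = trans (cong (λ t → K ℕ.+ 2 ℕ.+ (c ℕ.+ c ℕ.+ 1 ℕ.+ (g t ℕ.+ g t ℕ.+ 1) ℕ.+ 1)) (cost-twoPow K k)) (arith K c k)
      where
      c = cost K W∘σ
      g : ℕ → ℕ
      g t = 0 ℕ.+ (2 ℕ.+ t ℕ.+ 1) ℕ.+ 1
      arith : ∀ K c k → K ℕ.+ 2 ℕ.+ (c ℕ.+ c ℕ.+ 1 ℕ.+ ((0 ℕ.+ (2 ℕ.+ suc (3 ℕ.* k) ℕ.+ 1) ℕ.+ 1) ℕ.+ (0 ℕ.+ (2 ℕ.+ suc (3 ℕ.* k) ℕ.+ 1) ℕ.+ 1) ℕ.+ 1) ℕ.+ 1)
                      ≡ K ℕ.+ 15 ℕ.+ 2 ℕ.* c ℕ.+ 6 ℕ.* k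
      arith = ℕ-Solver.solve-∀

    module _ (k : ℕ) (fits : K ℕ.+ 2 ℕ.+ cost K (P k) ≤ 2 ^ k) (b : ℕ) (isG : IsG (2 ^ k) b) where

      open Encoding (encode (P k) fits)

      A = 2 ^ k

      1≤A : 1 ≤ A
      1≤A = ℕP.m^n>0 2 k

      Lᵇ = proj₁ (finite-fold A b)
      bound = A ℕ.+ b ℕ.+ sum (List.map Vec.sum Lᵇ)

      -- By the representation the second argument of any zero is g(A) = b, and by finite-foldness its
      -- remaining arguments range over a finite list; this bounds every coordinate.
      zero-second≡b : ∀ z → eval (P k) z ≡ + 0 → second z ≡ b
      zero-second≡b z P≡0 = IsG-unique (proj₂ (Equivalence.from (represents A (second z)) (rest z , proj₂ (P≡0⇒ k z P≡0)))) isG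

      zero-rest∈L : ∀ z → eval (P k) z ≡ + 0 → rest z ∈ Lᵇ
      zero-rest∈L z P≡0 = proj₂ (finite-fold A b) (rest z)
        (subst (λ y → evalℕ W (A ∷ y ∷ rest z) ≡ + 0) (zero-second≡b z P≡0) (proj₂ (P≡0⇒ k z P≡0)))

      second≤bound : ∀ z → eval (P k) z ≡ + 0 → second z ≤ bound
      second≤bound z P≡0 = subst (_≤ bound) (sym (zero-second≡b z P≡0)) (ℕP.≤-trans (ℕP.m≤n+m b A) (ℕP.m≤m+n _ _))

      zero-normSq≤bound : ∀ z → eval (P k) z ≡ + 0 → ∀ j → normSq (block z j) ≤ bound
      zero-normSq≤bound z P≡0 Fin.zero =
        ℕP.≤-trans (ℕP.m≤m+n (normSq (block z Fin.zero)) (normSq (block z (Fin.suc Fin.zero)))) (second≤bound z P≡0)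
      zero-normSq≤bound z P≡0 (Fin.suc Fin.zero) =
        ℕP.≤-trans (ℕP.m≤n+m (normSq (block z (Fin.suc Fin.zero))) (normSq (block z Fin.zero))) (second≤bound z P≡0)
      zero-normSq≤bound z P≡0 (Fin.suc (Fin.suc j)) = begin
        normSq (block z (Fin.suc (Fin.suc j)))  ≡⟨ sym (VecP.lookup∘tabulate (λ j → normSq (block z (Fin.suc (Fin.suc j)))) j) ⟩
        lookup (rest z) j                       ≤⟨ lookup≤sum (rest z) j ⟩
        Vec.sum (rest z)                        ≤⟨ ∈⇒≤sum (∈P.∈-map⁺ Vec.sum (zero-rest∈L z P≡0)) ⟩
        sum (List.map Vec.sum Lᵇ)               ≤⟨ ℕP.m≤n+m _ _ ⟩
        bound                                   ∎
        where open ℕP.≤-Reasoning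

      zero-bounded : ∀ z → eval (P k) z ≡ + 0 → ∀ i → ∣ lookup z i ∣ ≤ bound
      zero-bounded z P≡0 = Fin-K-cases (λ i → ∣ lookup z i ∣ ≤ bound)
        (subst (λ x → ∣ x ∣ ≤ bound) (sym (proj₁ (P≡0⇒ k z P≡0))) (ℕP.≤-trans (ℕP.m≤m+n A b) (ℕP.m≤m+n _ _)))
        (λ j r → subst (λ x → ∣ x ∣ ≤ bound) (VecP.lookup∘tabulate (λ r → lookup z (blockVar j r)) r)
                   (ℕP.≤-trans (∣entry∣≤normSq (block z j) r) (zero-normSq≤bound z P≡0 j)))

      solutions-finite : Σ ℕ (HasExactlySolutions system)
      solutions-finite = cover⇒hasExactlySolutions system (List.map embed (box K (range bound))) covered
        where
        covered : ∀ v → Solution system v → v ∈ List.map embed (box K (range bound))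
        covered v sol = subst (_∈ _) (sym (proj₂ (solution-embed v sol)))
          (∈P.∈-map⁺ embed (bounded-∈-box bound (restrict v) (zero-bounded (restrict v) (proj₁ (solution-embed v sol)))))

      -- Splitting b = y + (b - y) for y ≤ b gives b + 1 distinct zeros.
      xs₀ = proj₁ (Equivalence.to (represents A b) (1≤A , isG))

      blocks : ℕ → Vec (Vec ℤ 4) (2 ℕ.+ m)
      blocks y = fourSquares y ∷ fourSquares (b ∸ y) ∷ Vec.map fourSquares xs₀

      split : ℕ → Vec ℤ K
      split y = assemble A (blocks y)

      split-zero : ∀ y → y ≤ b → eval (P k) (split y) ≡ + 0
      split-zero y y≤b = ⇒P≡0 k (split y) refl
        (subst (λ x → evalℕ W (A ∷ x) ≡ + 0) (sym (cong₂ _∷_ second≡b rest≡xs₀)) (proj₂ (Equivalence.to (represents A b) (1≤A , isG))))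
        where
        normSq-block : ∀ j → normSq (block (split y) j) ≡ normSq (lookup (blocks y) j)
        normSq-block j = cong normSq (block-assemble A (blocks y) j)
        second≡b : second (split y) ≡ b
        second≡b = trans (cong₂ ℕ._+_ (trans (normSq-block Fin.zero) (normSq-fourSquares y))
                                       (trans (normSq-block (Fin.suc Fin.zero)) (normSq-fourSquares (b ∸ y))))
                         (ℕP.m+[n∸m]≡n y≤b)
        rest≡xs₀ : rest (split y) ≡ xs₀
        rest≡xs₀ = lookup-ext λ j → begin
          lookup (rest (split y)) j                        ≡⟨ VecP.lookup∘tabulate (λ j → normSq (block (split y) (Fin.suc (Fin.suc j)))) j ⟩
          normSq (block (split y) (Fin.suc (Fin.suc j)))   ≡⟨ normSq-block (Fin.suc (Fin.suc j)) ⟩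
          normSq (lookup (Vec.map fourSquares xs₀) j)      ≡⟨ cong normSq (VecP.lookup-map j fourSquares xs₀) ⟩
          normSq (fourSquares (lookup xs₀ j))              ≡⟨ normSq-fourSquares (lookup xs₀ j) ⟩
          lookup xs₀ j                                     ∎
          where open ≡-Reasoning

      split-injective : ∀ {x y} → split x ≡ split y → x ≡ y
      split-injective {x} {y} eq = ℤP.+-injective (begin
        + x                                       ≡⟨ sym (sumSqVec-fourSquares x) ⟩
        sumSqVec (fourSquares x)                  ≡⟨ cong sumSqVec (sym (block-assemble A (blocks x) Fin.zero)) ⟩
        sumSqVec (block (split x) Fin.zero)       ≡⟨ cong (λ z → sumSqVec (block z Fin.zero)) eq ⟩
        sumSqVec (block (split y) Fin.zero)       ≡⟨ cong sumSqVec (block-assemble A (blocks y) Fin.zero) ⟩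
        sumSqVec (fourSquares y)                  ≡⟨ sumSqVec-fourSquares y ⟩
        + y                                       ∎)
        where open ≡-Reasoning

      splits : List (Vec ℤ A)
      splits = applyUpTo (embed ∘ split) (suc b)

      splits-unique : Unique splits
      splits-unique = UniqueP.applyUpTo⁺₁ (embed ∘ split) (suc b) λ i<j _ eq →
        ℕP.<-irrefl (split-injective (trans (sym (restrict-embed _)) (trans (cong restrict eq) (restrict-embed _)))) i<j

      splits-solutions : All (Solution system) splits
      splits-solutions = AllP.applyUpTo⁺₁ (embed ∘ split) (suc b) λ y<1+b → embed-solution _ (split-zero _ (ℕ.s≤s⁻¹ y<1+b))

      many-solutions : ∀ c → HasExactlySolutions system c → suc b ≤ c
      many-solutions c exact = subst (_≤ c) (ListP.length-applyUpTo (embed ∘ split) (suc b))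
        (unique-solutions-≤ system splits exact splits-unique splits-solutions)

      g-refuted : ⊥
      g-refuted = let c , exact = solutions-finite in
        ℕP.<-irrefl refl (ℕP.<-≤-trans (many-solutions c exact) (proj₂ isG system c exact))


open Reduction using (module Layout; module Refutation)
open Preliminaries using (linear<exponential)
open GreatestSolutionCount using (¬¬-g-exists)
open PolynomialCompiler using (cost)

open import Defs
open import Data.Nat using (ℕ; _≤_; _+_; _*_; _^_)
open import Data.Integer using (+_)
open import Data.Vec using (Vec; _∷_)
open import Data.List using (List)
open import Data.List.Membership.Propositional using (_∈_)
open import Data.Product using (Σ; _×_; _,_)
open import Relation.Nullary using (¬_)
open import Relation.Binary.PropositionalEquality using (_≡_; subst; sym)
open import Function.Bundles using (_⇔_)

theorem4 : ¬ (Σ ℕ λ m → Σ (Poly (2 + m)) λ W →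
               (∀ (a b : ℕ) →
                  ((1 ≤ a × IsG a b) ⇔ Σ (Vec ℕ m) λ xs → evalℕ W (a ∷ b ∷ xs) ≡ + 0))
               × (∀ (a b : ℕ) →
                  Σ (List (Vec ℕ m)) λ L →
                    ∀ (xs : Vec ℕ m) → evalℕ W (a ∷ b ∷ xs) ≡ + 0 → xs ∈ L))
theorem4 (m , W , represents , finite-fold) =
  let k , fits = linear<exponential (K + 15 + 2 * cost K W∘σ) 6 in
  ¬¬-g-exists (2 ^ k) λ (b , isG) → g-refuted k (subst (_≤ 2 ^ k) (sym (size-P k)) fits) b isG
  where
  open Layout m
  open Refutation m W represents finite-fold
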